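{- Let $a,b_1,b_2,c$ be constants with $b_2\neq 0$, and let $G(x)=G^{2,4}(x,a,b_1,b_2,c)$ be the unique formal power series solution of \[ G(x)=\frac{a}{1+b_1x+b_2x^2+cx^4G(x)}. \] If $H_n(G)\neq 0$ for all $n\ge 0$, then for all $n\ge1$ \begin{align*} H_{2n+1}(G) =& b_2 a^{2n+1} (ac)^{n^2} B_{n-1}\left(\frac{ac}{b_2}, \frac{2ac+b_2^2}{b_2}, -\frac{ac}{b_2}\right),\\ H_{2n}(G)=&(-1)^nb_2a^{2n}(ac)^{n(n-1)} B_{n-1}\left(\frac{ac}{b_2}, \frac{2ac+b_2^2}{b_2}, -\frac{ac}{b_2}\right). \end{align*}
   Context: $G^{2,4}$ is the (weighted) generating function of lattice paths with steps $(1,0),(2,0),(3,1),(-1,1)$ of weights $b_1,b_2,c,1$ that stay weakly above and return to the $x$-axis (times $a$); it is characterized by the functional equation above. For a formal power series $A(x)=\sum_{n\ge0}a_nx^n$, $H_n(A(x))=\det(a_{i+j})_{0\le i,j\le n-1}$, with $H_0(A(x))=1$. For constants $a',c',d'$, the sequence $B_n(a',c',d')$ is defined by $B_0=1$, $B_1=c'-a'$, and $B_{n+1}=\beta B_n+\alpha B_{n-1}$ for $n\ge1$, where $\alpha=a'(c'+d'-a')$ and $\beta=c'-2a'$. -}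

module Defs where

open import Level using (_⊔_)
open import Data.Nat using (ℕ; zero; suc)
import Data.Nat as N
open import Data.Fin using (Fin; toℕ; punchIn)
import Data.Fin as F
open import Data.Product using (∃)
open import Relation.Nullary using (¬_)
open import Algebra.Bundles using (CommutativeRing)

module _ {c ℓ} (R : CommutativeRing c ℓ) where
  open CommutativeRing R renaming (Carrier to A) hiding (zero)

  IsField : Set (c ⊔ ℓ)
  IsField = (¬ (1# ≈ 0#)) Data.Product.× (∀ x → ¬ (x ≈ 0#) → ∃ λ y → x * y ≈ 1#)

  pow : A → ℕ → A
  pow x zero = 1#
  pow x (suc n) = x * pow x n

  sgn : ℕ → A
  sgn zero = 1#
  sgn (suc k) = - sgn k

  sumFin : ∀ n → (Fin n → A) → A
  sumFin zero f = 0#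
  sumFin (suc n) f = f F.zero + sumFin n (λ i → f (F.suc i))

  det : ∀ n → (Fin n → Fin n → A) → A
  det zero M = 1#
  det (suc n) M =
    sumFin (suc n) (λ j → sgn (toℕ j) * (M F.zero j * det n (λ i k → M (F.suc i) (punchIn j k))))

  -- formal power series = coefficient sequences; Hankel determinant H_n(A) = det (a_{i+j})_{0≤i,j≤n-1}
  Hankel : (ℕ → A) → ℕ → A
  Hankel g n = det n (λ i j → g (toℕ i N.+ toℕ j))

  conv : (ℕ → A) → (ℕ → A) → ℕ → A
  conv f g n = sumFin (suc n) (λ k → f (toℕ k) * g (n N.∸ toℕ k))

  -- coefficients of the denominator 1 + b1 x + b2 x^2 + c x^4 G(x)
  denom : A → A → A → (ℕ → A) → ℕ → A
  denom b1 b2 cc g zero = 1#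
  denom b1 b2 cc g (suc zero) = b1
  denom b1 b2 cc g (suc (suc zero)) = b2
  denom b1 b2 cc g (suc (suc (suc zero))) = 0#
  denom b1 b2 cc g (suc (suc (suc (suc n)))) = cc * g n

  -- G satisfies G(x) = a / (1 + b1 x + b2 x^2 + c x^4 G(x)) as formal power series,
  -- i.e. G(x) · (1 + b1 x + b2 x^2 + c x^4 G(x)) = a (denominator has constant term 1, so is invertible)
  IsG24 : A → A → A → A → (ℕ → A) → Set ℓ
  IsG24 a b1 b2 cc g =
    (conv g (denom b1 b2 cc g) zero ≈ a) Data.Product.×
    (∀ n → conv g (denom b1 b2 cc g) (suc n) ≈ 0#)

  B : A → A → A → ℕ → A
  B a' c' d' zero = 1#
  B a' c' d' (suc zero) = c' - a'
  B a' c' d' (suc (suc n)) =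
    (c' - (a' + a')) * B a' c' d' (suc n) + (a' * ((c' + d') - a')) * B a' c' d' n

module Submission where

open import Defs
open import Level using (Level)
open import Data.Nat using (ℕ; suc)
import Data.Nat as N
open import Data.Product using (_×_)
open import Relation.Nullary using (¬_)
open import Algebra.Bundles using (CommutativeRing)

open import Data.Nat using (zero)
import Data.Nat.Properties as N
open import Data.Nat.Induction using (<-rec)
open import Data.Nat.Tactic.RingSolver using (solve-∀)
open import Data.Fin as F using (Fin; zero; suc; toℕ; punchIn; punchOut; inject₁)
import Data.Fin.Properties as F
import Data.Integer as ℤ
open import Data.Integer using (0ℤ; 1ℤ)
import Data.Integer.Properties as ℤ
open import Data.Sign as Sign using (Sign)
open import Data.Maybe using (Maybe; just; nothing)
open import Data.Product using (∃; _,_; proj₁; proj₂)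
open import Data.Sum using (_⊎_; inj₁; inj₂)
open import Data.Empty using (⊥-elim)
open import Function using (_∘_)
open import Relation.Binary.PropositionalEquality as ≡ using (_≡_; _≢_)
open import Relation.Binary.Definitions using (tri<; tri≈; tri>)
open import Relation.Nullary using (yes; no)

-- If f · u = h₀ with u₀ = 1, multiplying the Hankel matrix of f on both sides by the unitriangular
-- Toeplitz matrix of u gives H_{m+1}(f) = h₀^{m+1} H_m(−u_{k+2}). As G · D = a for
-- D = 1 + b₁x + b₂x² + cx⁴G, this yields H_{m+1}(G) = a^{m+1} H_m(F_{b₂}) with F_β = −β − cx²G.
-- Two further applications of the same identity, to F_β with u = 1 − e x² / D_{b₂+e} (e = ac/β) and
-- to 1 / D_{b₂+e}, give H_{m+2}(F_β) = (−β)(−ac)^{m+1} H_m(F_{b₂+e}). Iterating along β₀ = b₂,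
-- βₖ₊₁ = b₂ + ac/βₖ, the products β₀⋯βₖ obey Q_{k+1} = b₂Q_k + acQ_{k−1}, so they equal b₂Bₖ; the
-- nonvanishing of the Hankel determinants is what keeps every βₖ invertible.

-- The ring solver needs coefficients whose equality it can decide; ℤ maps into every ring.
module IntegerCoefficients {c ℓ} (R : CommutativeRing c ℓ) where
  open import Data.Integer using (ℤ; +_; -[1+_]; _⊖_; _◃_; sign; ∣_∣)
  open CommutativeRing R
  open import Algebra.Properties.Ring ring using (-‿distribˡ-*; -‿involutive; -0#≈0#; -‿+-comm)
  open import Algebra.Properties.Semiring.Mult.TCOptimised semiring using (1+×; ×-homo-+; ×1-homo-*) renaming (_×_ to _×′_)
  open import Relation.Binary.Reasoning.Setoid setoid
  import Algebra.Solver.Ring.AlmostCommutativeRing as ACR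

  ⟦_⟧ : ℤ → Carrier
  ⟦ + n ⟧ = n ×′ 1#
  ⟦ -[1+ n ] ⟧ = - (suc n ×′ 1#)

  ⟦_⟧ₛ : Sign → Carrier
  ⟦ Sign.+ ⟧ₛ = 1#
  ⟦ Sign.- ⟧ₛ = - 1#

  ⟦⟧ₛ-homo-* : ∀ s t → ⟦ s Sign.* t ⟧ₛ ≈ ⟦ s ⟧ₛ * ⟦ t ⟧ₛ
  ⟦⟧ₛ-homo-* Sign.+ t = sym (*-identityˡ _)
  ⟦⟧ₛ-homo-* Sign.- Sign.+ = sym (*-identityʳ _)
  ⟦⟧ₛ-homo-* Sign.- Sign.- = begin
    1#              ≈⟨ -‿involutive 1# ⟨
    - - 1#          ≈⟨ -‿cong (*-identityˡ _) ⟨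
    - (1# * - 1#)   ≈⟨ -‿distribˡ-* _ _ ⟩
    - 1# * - 1#     ∎

  ⟦◃⟧ : ∀ s n → ⟦ s ◃ n ⟧ ≈ ⟦ s ⟧ₛ * (n ×′ 1#)
  ⟦◃⟧ s zero = sym (zeroʳ _)
  ⟦◃⟧ Sign.+ (suc n) = sym (*-identityˡ _)
  ⟦◃⟧ Sign.- (suc n) = trans (-‿cong (sym (*-identityˡ _))) (-‿distribˡ-* _ _)

  ⟦⟧-homo-* : ∀ i j → ⟦ i ℤ.* j ⟧ ≈ ⟦ i ⟧ * ⟦ j ⟧
  ⟦⟧-homo-* i j = begin
    ⟦ sign i Sign.* sign j ◃ ∣ i ∣ N.* ∣ j ∣ ⟧
      ≈⟨ ⟦◃⟧ (sign i Sign.* sign j) (∣ i ∣ N.* ∣ j ∣) ⟩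
    ⟦ sign i Sign.* sign j ⟧ₛ * ((∣ i ∣ N.* ∣ j ∣) ×′ 1#)
      ≈⟨ *-cong (⟦⟧ₛ-homo-* (sign i) (sign j)) (×1-homo-* ∣ i ∣ ∣ j ∣) ⟩
    (⟦ sign i ⟧ₛ * ⟦ sign j ⟧ₛ) * ((∣ i ∣ ×′ 1#) * (∣ j ∣ ×′ 1#))
      ≈⟨ interchange _ _ _ _ ⟩
    (⟦ sign i ⟧ₛ * (∣ i ∣ ×′ 1#)) * (⟦ sign j ⟧ₛ * (∣ j ∣ ×′ 1#))
      ≈⟨ *-cong (signed i) (signed j) ⟨
    ⟦ i ⟧ * ⟦ j ⟧ ∎
    where
    open import Algebra.Properties.CommutativeSemigroup *-commutativeSemigroup using (interchange)
    signed : ∀ i → ⟦ i ⟧ ≈ ⟦ sign i ⟧ₛ * (∣ i ∣ ×′ 1#)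
    signed i = trans (reflexive (≡.cong ⟦_⟧ (≡.sym (ℤ.◃-inverse i)))) (⟦◃⟧ (sign i) ∣ i ∣)

  ⟦⊖⟧ : ∀ m n → ⟦ m ⊖ n ⟧ ≈ m ×′ 1# - n ×′ 1#
  ⟦⊖⟧ m zero = sym (trans (+-congˡ -0#≈0#) (+-identityʳ _))
  ⟦⊖⟧ zero (suc n) = sym (+-identityˡ _)
  ⟦⊖⟧ (suc m) (suc n) = begin
    ⟦ suc m ⊖ suc n ⟧            ≡⟨ ≡.cong ⟦_⟧ (ℤ.[1+m]⊖[1+n]≡m⊖n m n) ⟩
    ⟦ m ⊖ n ⟧                    ≈⟨ ⟦⊖⟧ m n ⟩
    x - y                        ≈⟨ +-identityˡ _ ⟨
    0# + (x - y)                 ≈⟨ +-congʳ (-‿inverseʳ 1#) ⟨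
    (1# - 1#) + (x - y)          ≈⟨ +-assoc 1# (- 1#) (x - y) ⟩
    1# + (- 1# + (x - y))        ≈⟨ +-congˡ (x∙yz≈y∙xz (- 1#) x (- y)) ⟩
    1# + (x + (- 1# - y))        ≈⟨ +-congˡ (+-congˡ (-‿+-comm 1# y)) ⟩
    1# + (x + - (1# + y))        ≈⟨ +-assoc 1# x _ ⟨
    (1# + x) - (1# + y)          ≈⟨ +-cong (1+× m 1#) (-‿cong (1+× n 1#)) ⟨
    suc m ×′ 1# - suc n ×′ 1#    ∎
    where
    x y : Carrier
    x = m ×′ 1#
    y = n ×′ 1#
    open import Algebra.Properties.CommutativeSemigroup +-commutativeSemigroup using (x∙yz≈y∙xz)

  ⟦⟧-homo-+ : ∀ i j → ⟦ i ℤ.+ j ⟧ ≈ ⟦ i ⟧ + ⟦ j ⟧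
  ⟦⟧-homo-+ -[1+ m ] -[1+ n ] = begin
    - (suc (suc (m N.+ n)) ×′ 1#)        ≡⟨ ≡.cong (λ k → - (suc k ×′ 1#)) (N.+-suc m n) ⟨
    - ((suc m N.+ suc n) ×′ 1#)          ≈⟨ -‿cong (×-homo-+ 1# (suc m) (suc n)) ⟩
    - (suc m ×′ 1# + suc n ×′ 1#)        ≈⟨ -‿+-comm _ _ ⟨
    - (suc m ×′ 1#) + - (suc n ×′ 1#)    ∎
  ⟦⟧-homo-+ -[1+ m ] (+ n) = trans (⟦⊖⟧ n (suc m)) (+-comm _ _)
  ⟦⟧-homo-+ (+ m) -[1+ n ] = ⟦⊖⟧ m (suc n)
  ⟦⟧-homo-+ (+ m) (+ n) = ×-homo-+ 1# m n

  ⟦⟧-homo-- : ∀ i → ⟦ ℤ.- i ⟧ ≈ - ⟦ i ⟧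
  ⟦⟧-homo-- -[1+ n ] = sym (-‿involutive _)
  ⟦⟧-homo-- (+ zero) = sym -0#≈0#
  ⟦⟧-homo-- (+ suc n) = refl

  private
    almostCommutativeRing : ACR.AlmostCommutativeRing c ℓ
    almostCommutativeRing = ACR.fromCommutativeRing R

    morphism : ℤ.+-*-rawRing ACR.-Raw-AlmostCommutative⟶ almostCommutativeRing
    morphism = record
      { ⟦_⟧ = ⟦_⟧
      ; +-homo = ⟦⟧-homo-+
      ; *-homo = ⟦⟧-homo-*
      ; -‿homo = ⟦⟧-homo--
      ; 0-homo = refl
      ; 1-homo = refl
      }

    ⟦⟧-≟ : ∀ i j → Maybe (⟦ i ⟧ ≈ ⟦ j ⟧)
    ⟦⟧-≟ i j with i ℤ.≟ j
    ... | yes ≡.refl = just refl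
    ... | no _ = nothing

  open import Algebra.Solver.Ring ℤ.+-*-rawRing almostCommutativeRing morphism ⟦⟧-≟ public
    using (solve; _:+_; _:*_; :-_; _:-_; _:=_; con)

m<n⇒n≡1+[n∸1+m]+m : ∀ {m n} → m N.< n → n ≡ suc ((n N.∸ suc m) N.+ m)
m<n⇒n≡1+[n∸1+m]+m {m} m<n = ≡.sym (≡.trans (≡.sym (N.+-suc _ m)) (N.m∸n+n≡m m<n))

Adjacent : ∀ {n} → Fin n → Fin n → Set
Adjacent p q = suc (toℕ p) ≡ toℕ q

adjacent⇒≢ : ∀ {n} {p q : Fin n} → Adjacent p q → p ≢ q
adjacent⇒≢ adj p≡q = N.1+n≢n (≡.trans adj (≡.cong toℕ (≡.sym p≡q)))

punchIn-adjacent : ∀ {n} {p q : Fin (suc n)} → Adjacent p q → ∀ l →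
  punchIn p l ≡ punchIn q l ⊎ (punchIn p l ≡ q × punchIn q l ≡ p)
punchIn-adjacent {p = zero} {suc zero} _ zero = inj₂ (≡.refl , ≡.refl)
punchIn-adjacent {p = zero} {suc zero} _ (suc l) = inj₁ ≡.refl
punchIn-adjacent {p = suc p} {suc q} _ zero = inj₁ ≡.refl
punchIn-adjacent {p = suc p} {suc q} adj (suc l) with punchIn-adjacent (N.suc-injective adj) l
... | inj₁ eq = inj₁ (≡.cong suc eq)
... | inj₂ (eqp , eqq) = inj₂ (≡.cong suc eqp , ≡.cong suc eqq)

punchOut-adjacent : ∀ {n} {j p q : Fin (suc n)} (j≢p : j ≢ p) (j≢q : j ≢ q) →
  Adjacent p q → Adjacent (punchOut j≢p) (punchOut j≢q)
punchOut-adjacent {j = zero} {zero} j≢p _ _ = ⊥-elim (j≢p ≡.refl)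
punchOut-adjacent {j = zero} {suc p} {suc q} _ _ adj = N.suc-injective adj
punchOut-adjacent {n = suc n} {suc zero} {zero} {suc zero} _ j≢q _ = ⊥-elim (j≢q ≡.refl)
punchOut-adjacent {n = suc (suc n)} {suc (suc j)} {zero} {suc zero} _ _ _ = ≡.refl
punchOut-adjacent {n = suc n} {suc j} {suc p} {suc q} j≢p j≢q adj =
  ≡.cong suc (punchOut-adjacent (j≢p ∘ ≡.cong suc) (j≢q ∘ ≡.cong suc) (N.suc-injective adj))

module Determinant {c ℓ} (R : CommutativeRing c ℓ) where
  open CommutativeRing R renaming (Carrier to A) hiding (zero)
  open IntegerCoefficients R using (solve; _:+_; _:*_; :-_; _:-_; _:=_; con)
  open import Algebra.Properties.Ring ring using (-‿involutive; -0#≈0#)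
  open import Relation.Binary.Reasoning.Setoid setoid

  -- sumFin and pow recurse on the length, so they are not definitionally the library's sum and _^_
  -- at a variable length; the few laws needed are proved directly.
  ∑ : ∀ n → (Fin n → A) → A
  ∑ = sumFin R

  ∑-cong : ∀ n {f g : Fin n → A} → (∀ i → f i ≈ g i) → ∑ n f ≈ ∑ n g
  ∑-cong zero e = refl
  ∑-cong (suc n) e = +-cong (e zero) (∑-cong n (e ∘ suc))

  ∑-distrib-+ : ∀ n (f g : Fin n → A) → ∑ n (λ i → f i + g i) ≈ ∑ n f + ∑ n g
  ∑-distrib-+ zero f g = sym (+-identityʳ 0#)
  ∑-distrib-+ (suc n) f g = trans (+-congˡ (∑-distrib-+ n (f ∘ suc) (g ∘ suc)))
    (solve 4 (λ a b x y → (a :+ b) :+ (x :+ y) := (a :+ x) :+ (b :+ y)) refl (f zero) (g zero) (∑ n (f ∘ suc)) (∑ n (g ∘ suc)))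

  *-distribˡ-∑ : ∀ n x (f : Fin n → A) → x * ∑ n f ≈ ∑ n (λ i → x * f i)
  *-distribˡ-∑ zero x f = zeroʳ x
  *-distribˡ-∑ (suc n) x f = trans (distribˡ x _ _) (+-congˡ (*-distribˡ-∑ n x (f ∘ suc)))

  ∑-zero : ∀ n {f : Fin n → A} → (∀ i → f i ≈ 0#) → ∑ n f ≈ 0#
  ∑-zero zero e = refl
  ∑-zero (suc n) e = trans (+-cong (e zero) (∑-zero n (e ∘ suc))) (+-identityʳ 0#)

  ∑-comm : ∀ m n (f : Fin m → Fin n → A) → ∑ m (λ i → ∑ n (f i)) ≈ ∑ n (λ j → ∑ m (λ i → f i j))
  ∑-comm zero n f = sym (∑-zero n (λ _ → refl))
  ∑-comm (suc m) n f = trans (+-congˡ (∑-comm m n (f ∘ suc))) (sym (∑-distrib-+ n (f zero) _))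

  ∑-single : ∀ n {f : Fin n → A} (k : Fin n) → (∀ i → i ≢ k → f i ≈ 0#) → ∑ n f ≈ f k
  ∑-single (suc n) zero e = trans (+-congˡ (∑-zero n (λ i → e (suc i) λ ()))) (+-identityʳ _)
  ∑-single (suc n) (suc k) e =
    trans (+-cong (e zero λ ()) (∑-single n k (λ i i≢k → e (suc i) (i≢k ∘ F.suc-injective)))) (+-identityˡ _)

  ∑-pair : ∀ n {f : Fin n → A} {p q : Fin n} → p ≢ q → (∀ i → i ≢ p → i ≢ q → f i ≈ 0#) → ∑ n f ≈ f p + f q
  ∑-pair (suc n) {p = zero} {zero} p≢q e = ⊥-elim (p≢q ≡.refl)
  ∑-pair (suc n) {p = zero} {suc q} p≢q e =
    +-congˡ (∑-single n q (λ i i≢q → e (suc i) (λ ()) (i≢q ∘ F.suc-injective)))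
  ∑-pair (suc n) {p = suc p} {zero} p≢q e =
    trans (+-congˡ (∑-single n p (λ i i≢p → e (suc i) (i≢p ∘ F.suc-injective) (λ ())))) (+-comm _ _)
  ∑-pair (suc n) {p = suc p} {suc q} p≢q e =
    trans (+-cong (e zero (λ ()) (λ ())) (∑-pair n (p≢q ∘ ≡.cong suc) (λ i i≢p i≢q → e (suc i) (i≢p ∘ F.suc-injective) (i≢q ∘ F.suc-injective))))
          (+-identityˡ _)

  ∑-last : ∀ n (f : Fin (suc n) → A) → ∑ (suc n) f ≈ ∑ n (f ∘ inject₁) + f (F.fromℕ n)
  ∑-last zero f = trans (+-identityʳ _) (sym (+-identityˡ _))
  ∑-last (suc n) f = trans (+-congˡ (∑-last n (f ∘ suc))) (sym (+-assoc _ _ _))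

  Matrix : ℕ → Set c
  Matrix n = Fin n → Fin n → A

  minor : ∀ {n} → Matrix (suc n) → Fin (suc n) → Matrix n
  minor M j i k = M (suc i) (punchIn j k)

  laplaceTerm : ∀ {n} → Matrix (suc n) → Fin (suc n) → A
  laplaceTerm {n} M j = sgn R (toℕ j) * (M zero j * det R n (minor M j))

  det-cong : ∀ n {M N : Matrix n} → (∀ i j → M i j ≈ N i j) → det R n M ≈ det R n N
  det-cong zero e = refl
  det-cong (suc n) {M} {N} e = ∑-cong (suc n) {laplaceTerm M} {laplaceTerm N}
    λ j → *-congˡ (*-cong (e zero j) (det-cong n λ i k → e (suc i) (punchIn j k)))

  det-scale : ∀ n x (M : Matrix n) → det R n (λ i j → x * M i j) ≈ pow R x n * det R n M
  det-scale zero x M = sym (*-identityˡ 1#)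
  det-scale (suc n) x M = begin
    det R (suc n) xM                                      ≈⟨ ∑-cong (suc n) {laplaceTerm xM} term ⟩
    ∑ (suc n) (λ j → pow R x (suc n) * laplaceTerm M j)   ≈⟨ *-distribˡ-∑ (suc n) (pow R x (suc n)) (laplaceTerm M) ⟨
    pow R x (suc n) * det R (suc n) M                     ∎
    where
    xM : Matrix (suc n)
    xM i j = x * M i j
    regroup : ∀ s x m p d → s * ((x * m) * (p * d)) ≈ (x * p) * (s * (m * d))
    regroup = solve 5 (λ s x m p d → s :* ((x :* m) :* (p :* d)) := (x :* p) :* (s :* (m :* d))) refl
    term : ∀ j → laplaceTerm xM j ≈ pow R x (suc n) * laplaceTerm M j
    term j = trans (*-congˡ (*-congˡ (det-scale n x (minor M j))))
                   (regroup (sgn R (toℕ j)) x (M zero j) (pow R x n) (det R n (minor M j)))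

  det-firstRowSingleEntry : ∀ n (M : Matrix (suc n)) → (∀ j → j ≢ zero → M zero j ≈ 0#) →
    det R (suc n) M ≈ M zero zero * det R n (λ i k → M (suc i) (suc k))
  det-firstRowSingleEntry n M row₀ = trans (∑-single (suc n) zero vanish) (*-identityˡ _)
    where
    vanish : ∀ j → j ≢ zero → laplaceTerm M j ≈ 0#
    vanish j j≢0 = trans (*-congˡ (trans (*-congʳ (row₀ j j≢0)) (zeroˡ _))) (zeroʳ _)

  det-adjacentEqualColumns : ∀ n (M : Matrix n) {p q} → Adjacent p q → (∀ i → M i p ≈ M i q) → det R n M ≈ 0#
  det-adjacentEqualColumns (suc n) M {p} {q} adj cols = begin
    det R (suc n) M                         ≈⟨ ∑-pair (suc n) (adjacent⇒≢ adj) vanish ⟩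
    laplaceTerm M p + laplaceTerm M q
      ≈⟨ +-congˡ (*-cong (reflexive (≡.cong (sgn R) (≡.sym adj))) (*-cong (sym (cols zero)) (det-cong n sameMinor))) ⟩
    s * (m * d) + (- s) * (m * d)           ≈⟨ solve 3 (λ s m d → s :* (m :* d) :+ (:- s) :* (m :* d) := con 0ℤ) refl s m d ⟩
    0#                                      ∎
    where
    s m d : A
    s = sgn R (toℕ p)
    m = M zero p
    d = det R n (minor M p)
    sameMinor : ∀ i l → minor M q i l ≈ minor M p i l
    sameMinor i l with punchIn-adjacent adj l
    ... | inj₁ eq = reflexive (≡.cong (M (suc i)) (≡.sym eq))
    ... | inj₂ (eqp , eqq) = trans (reflexive (≡.cong (M (suc i)) eqq)) (trans (cols (suc i)) (reflexive (≡.cong (M (suc i)) (≡.sym eqp))))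
    vanish : ∀ j → j ≢ p → j ≢ q → laplaceTerm M j ≈ 0#
    vanish j j≢p j≢q = trans (*-congˡ (trans (*-congˡ minor≈0) (zeroʳ _))) (zeroʳ _)
      where
      minor≈0 : det R n (minor M j) ≈ 0#
      minor≈0 = det-adjacentEqualColumns n (minor M j) (punchOut-adjacent j≢p j≢q adj) λ i →
        trans (reflexive (≡.cong (M (suc i)) (F.punchIn-punchOut j≢p)))
              (trans (cols (suc i)) (reflexive (≡.cong (M (suc i)) (≡.sym (F.punchIn-punchOut j≢q)))))

  det-linearInColumn : ∀ n (M N Q : Matrix n) (k : Fin n) (x : A) →
    (∀ i j → j ≢ k → M i j ≈ N i j) → (∀ i j → j ≢ k → M i j ≈ Q i j) →
    (∀ i → M i k ≈ x * N i k + Q i k) → det R n M ≈ x * det R n N + det R n Q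
  det-linearInColumn (suc n) M N Q k x offN offQ colₖ = begin
    det R (suc n) M                                           ≈⟨ ∑-cong (suc n) {laplaceTerm M} term ⟩
    ∑ (suc n) (λ j → x * laplaceTerm N j + laplaceTerm Q j)   ≈⟨ ∑-distrib-+ (suc n) (λ j → x * laplaceTerm N j) (laplaceTerm Q) ⟩
    ∑ (suc n) (λ j → x * laplaceTerm N j) + det R (suc n) Q   ≈⟨ +-congʳ (*-distribˡ-∑ (suc n) x (laplaceTerm N)) ⟨
    x * det R (suc n) N + det R (suc n) Q                     ∎
    where
    term : ∀ j → laplaceTerm M j ≈ x * laplaceTerm N j + laplaceTerm Q j
    term j with j F.≟ k
    ... | yes ≡.refl = begin
      s * (M zero j * det R n (minor M j))          ≈⟨ *-congˡ (*-cong (colₖ zero) (det-cong n minorMN)) ⟩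
      s * ((x * N zero j + Q zero j) * dN)
        ≈⟨ solve 5 (λ s x a b d → s :* ((x :* a :+ b) :* d) := x :* (s :* (a :* d)) :+ s :* (b :* d)) refl s x (N zero j) (Q zero j) dN ⟩
      x * laplaceTerm N j + s * (Q zero j * dN)     ≈⟨ +-congˡ (*-congˡ (*-congˡ (det-cong n minorNQ))) ⟩
      x * laplaceTerm N j + laplaceTerm Q j         ∎
      where
      s dN : A
      s = sgn R (toℕ j)
      dN = det R n (minor N j)
      minorMN : ∀ i l → minor M j i l ≈ minor N j i l
      minorMN i l = offN (suc i) (punchIn j l) (F.punchInᵢ≢i j l)
      minorNQ : ∀ i l → minor N j i l ≈ minor Q j i l
      minorNQ i l = trans (sym (minorMN i l)) (offQ (suc i) (punchIn j l) (F.punchInᵢ≢i j l))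
    ... | no j≢k = begin
      s * (M zero j * det R n (minor M j))                        ≈⟨ *-congˡ (*-congˡ minorLinear) ⟩
      s * (M zero j * (x * det R n (minor N j) + det R n (minor Q j)))
        ≈⟨ solve 5 (λ s m x d e → s :* (m :* (x :* d :+ e)) := x :* (s :* (m :* d)) :+ s :* (m :* e)) refl s (M zero j) x _ _ ⟩
      x * (s * (M zero j * _)) + s * (M zero j * _)
        ≈⟨ +-cong (*-congˡ (*-congˡ (*-congʳ (offN zero j j≢k)))) (*-congˡ (*-congʳ (offQ zero j j≢k))) ⟩
      x * laplaceTerm N j + laplaceTerm Q j                        ∎
      where
      s : A
      s = sgn R (toℕ j)
      k′ : Fin n
      k′ = punchOut j≢k
      off : ∀ {l} → l ≢ k′ → punchIn j l ≢ k
      off l≢k′ eq = l≢k′ (F.punchIn-injective j _ k′ (≡.trans eq (≡.sym (F.punchIn-punchOut j≢k))))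
      atk′ : ∀ (N : Matrix (suc n)) i → minor N j i k′ ≡ N (suc i) k
      atk′ N i = ≡.cong (N (suc i)) (F.punchIn-punchOut j≢k)
      minorLinear : det R n (minor M j) ≈ x * det R n (minor N j) + det R n (minor Q j)
      minorLinear = det-linearInColumn n (minor M j) (minor N j) (minor Q j) k′ x
        (λ i l l≢k′ → offN (suc i) (punchIn j l) (off l≢k′))
        (λ i l l≢k′ → offQ (suc i) (punchIn j l) (off l≢k′))
        (λ i → trans (reflexive (atk′ M i)) (trans (colₖ (suc i)) (sym (+-cong (*-congˡ (reflexive (atk′ N i))) (reflexive (atk′ Q i))))))

  det-additiveInColumn : ∀ n (M N Q : Matrix n) (k : Fin n) →
    (∀ i j → j ≢ k → M i j ≈ N i j) → (∀ i j → j ≢ k → M i j ≈ Q i j) →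
    (∀ i → M i k ≈ N i k + Q i k) → det R n M ≈ det R n N + det R n Q
  det-additiveInColumn n M N Q k offN offQ colₖ =
    trans (det-linearInColumn n M N Q k 1# offN offQ (λ i → trans (colₖ i) (+-congʳ (sym (*-identityˡ _)))))
          (+-congʳ (*-identityˡ _))

  det-zeroColumn : ∀ n (M : Matrix n) (k : Fin n) → (∀ i → M i k ≈ 0#) → det R n M ≈ 0#
  det-zeroColumn n M k zeroₖ = begin
    det R n M                            ≈⟨ solve 1 (λ d → d := (d :+ d) :- d) refl _ ⟩
    (det R n M + det R n M) - det R n M  ≈⟨ +-congʳ doubled ⟨
    det R n M - det R n M                ≈⟨ -‿inverseʳ _ ⟩
    0#                                   ∎
    where
    -- a zero column is the sum of two zero columns
    doubled : det R n M ≈ det R n M + det R n M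
    doubled = det-additiveInColumn n M M M k (λ _ _ _ → refl) (λ _ _ _ → refl)
      (λ i → trans (zeroₖ i) (sym (trans (+-cong (zeroₖ i) (zeroₖ i)) (+-identityʳ 0#))))

  column : ∀ {n} → Matrix n → Fin n → Fin n → A
  column M q i = M i q

  replaceColumn : ∀ {n} → Matrix n → Fin n → (Fin n → A) → Matrix n
  replaceColumn M k v i j with j F.≟ k
  ... | yes _ = v i
  ... | no _ = M i j

  replaceColumn-at : ∀ {n} (M : Matrix n) k v i → replaceColumn M k v i k ≈ v i
  replaceColumn-at M k v i with k F.≟ k
  ... | yes _ = refl
  ... | no k≢k = ⊥-elim (k≢k ≡.refl)

  replaceColumn-off : ∀ {n} (M : Matrix n) k v i {j} → j ≢ k → replaceColumn M k v i j ≈ M i j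
  replaceColumn-off M k v i {j} j≢k with j F.≟ k
  ... | yes j≡k = ⊥-elim (j≢k j≡k)
  ... | no _ = refl

  replaceColumn-self : ∀ {n} (M : Matrix n) k i j → replaceColumn M k (column M k) i j ≈ M i j
  replaceColumn-self M k i j with j F.≟ k
  ... | yes ≡.refl = refl
  ... | no _ = refl

  module TwoColumns {n} (M : Matrix n) {p q : Fin n} (p≢q : p ≢ q) where

    X : (Fin n → A) → (Fin n → A) → Matrix n
    X u v = replaceColumn (replaceColumn M p u) q v

    X-p : ∀ u v i → X u v i p ≈ u i
    X-p u v i = trans (replaceColumn-off _ q v i p≢q) (replaceColumn-at M p u i)

    X-q : ∀ u v i → X u v i q ≈ v i
    X-q u v i = replaceColumn-at _ q v i

    X-off : ∀ u v i {j} → j ≢ p → j ≢ q → X u v i j ≈ M i j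
    X-off u v i j≢p j≢q = trans (replaceColumn-off _ q v i j≢q) (replaceColumn-off M p u i j≢p)

    byColumn : ∀ (P : Fin n → Set ℓ) → P p → P q → (∀ {j} → j ≢ p → j ≢ q → P j) → ∀ j → P j
    byColumn P atp atq off j with j F.≟ p | j F.≟ q
    ... | yes ≡.refl | _ = atp
    ... | no _ | yes ≡.refl = atq
    ... | no j≢p | no j≢q = off j≢p j≢q

    X-offp : ∀ u u′ v i j → j ≢ p → X u v i j ≈ X u′ v i j
    X-offp u u′ v i = byColumn (λ j → j ≢ p → X u v i j ≈ X u′ v i j)
      (λ p≢p → ⊥-elim (p≢p ≡.refl))
      (λ _ → trans (X-q u v i) (sym (X-q u′ v i)))
      (λ j≢p j≢q _ → trans (X-off u v i j≢p j≢q) (sym (X-off u′ v i j≢p j≢q)))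

    X-offq : ∀ u v v′ i j → j ≢ q → X u v i j ≈ X u v′ i j
    X-offq u v v′ i = byColumn (λ j → j ≢ q → X u v i j ≈ X u v′ i j)
      (λ _ → trans (X-p u v i) (sym (X-p u v′ i)))
      (λ q≢q → ⊥-elim (q≢q ≡.refl))
      (λ j≢p j≢q _ → trans (X-off u v i j≢p j≢q) (sym (X-off u v′ i j≢p j≢q)))

    X-self : ∀ i j → X (column M p) (column M q) i j ≈ M i j
    X-self i = byColumn (λ j → X (column M p) (column M q) i j ≈ M i j) (X-p _ _ i) (X-q _ _ i) (X-off _ _ i)

    det-additiveˡ : ∀ u u′ v → det R n (X (λ i → u i + u′ i) v) ≈ det R n (X u v) + det R n (X u′ v)
    det-additiveˡ u u′ v = det-additiveInColumn n _ _ _ p (λ i j → X-offp _ u v i j) (λ i j → X-offp _ u′ v i j)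
      (λ i → trans (X-p _ v i) (sym (+-cong (X-p u v i) (X-p u′ v i))))

    det-additiveʳ : ∀ u v v′ → det R n (X u (λ i → v i + v′ i)) ≈ det R n (X u v) + det R n (X u v′)
    det-additiveʳ u v v′ = det-additiveInColumn n _ _ _ q (λ i j → X-offq u _ v i j) (λ i j → X-offq u _ v′ i j)
      (λ i → trans (X-q u _ i) (sym (+-cong (X-q u v i) (X-q u v′ i))))

  swapColumns : ∀ {n} → Matrix n → Fin n → Fin n → Matrix n
  swapColumns M p q = replaceColumn (replaceColumn M p (column M q)) q (column M p)

  det-swapAdjacentColumns : ∀ n (M : Matrix n) {p q} → Adjacent p q → det R n (swapColumns M p q) ≈ - det R n M
  det-swapAdjacentColumns n M {p} {q} adj = begin
    ba                                        ≈⟨ solve 4 (λ aa ab ba bb → ba := (((aa :+ ab) :+ (ba :+ bb)) :- aa :- bb) :- ab) refl aa ab ba bb ⟩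
    (((aa + ab) + (ba + bb)) - aa - bb) - ab
      ≈⟨ +-cong (+-cong (+-cong expanded (-‿cong (equal a))) (-‿cong (equal b))) (-‿cong (det-cong n X-self)) ⟩
    ((0# - 0#) - 0#) - det R n M              ≈⟨ solve 1 (λ d → ((con 0ℤ :- con 0ℤ) :- con 0ℤ) :- d := :- d) refl _ ⟩
    - det R n M                               ∎
    where
    open TwoColumns M (adjacent⇒≢ adj)
    a b s : Fin n → A
    a = column M p
    b = column M q
    s i = a i + b i
    aa ab ba bb : A
    aa = det R n (X a a)
    ab = det R n (X a b)
    ba = det R n (X b a)
    bb = det R n (X b b)
    equal : ∀ u → det R n (X u u) ≈ 0#
    equal u = det-adjacentEqualColumns n (X u u) adj (λ i → trans (X-p u u i) (sym (X-q u u i)))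
    expanded : (aa + ab) + (ba + bb) ≈ 0#
    expanded = begin
      (aa + ab) + (ba + bb)                ≈⟨ +-cong (det-additiveʳ a a b) (det-additiveʳ b a b) ⟨
      det R n (X a s) + det R n (X b s)    ≈⟨ det-additiveˡ a b s ⟨
      det R n (X s s)                      ≈⟨ equal s ⟩
      0#                                   ∎

  -- Swapping column q with its left neighbour brings the equal pair one step closer.
  det-equalColumnsAtDistance : ∀ d n (M : Matrix n) {p q} → toℕ q ≡ suc (d N.+ toℕ p) →
    (∀ i → M i p ≈ M i q) → det R n M ≈ 0#
  det-equalColumnsAtDistance zero n M dist cols = det-adjacentEqualColumns n M (≡.sym dist) cols
  det-equalColumnsAtDistance (suc d) (suc n) M {q = zero} ()
  det-equalColumnsAtDistance (suc d) (suc n) M {p} {suc r} dist cols = begin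
    det R (suc n) M          ≈⟨ -‿involutive _ ⟨
    - (- det R (suc n) M)    ≈⟨ -‿cong (det-swapAdjacentColumns (suc n) M adj) ⟨
    - det R (suc n) N        ≈⟨ -‿cong (det-equalColumnsAtDistance d (suc n) N distᵣ colsN) ⟩
    - 0#                     ≈⟨ -0#≈0# ⟩
    0#                       ∎
    where
    r′ : Fin (suc n)
    r′ = inject₁ r
    N : Matrix (suc n)
    N = swapColumns M r′ (suc r)
    distᵣ : toℕ r′ ≡ suc (d N.+ toℕ p)
    distᵣ = ≡.trans (F.toℕ-inject₁ r) (N.suc-injective dist)
    adj : Adjacent r′ (suc r)
    adj = ≡.cong suc (F.toℕ-inject₁ r)
    p≢r′ : p ≢ r′
    p≢r′ p≡r′ = N.m≢1+n+m (toℕ p) (≡.trans (≡.cong toℕ p≡r′) distᵣ)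
    p≢q : p ≢ suc r
    p≢q p≡q = N.m≢1+n+m (toℕ p) (≡.trans (≡.cong toℕ p≡q) dist)
    open TwoColumns M (adjacent⇒≢ adj)
    colsN : ∀ i → N i p ≈ N i r′
    colsN i = trans (X-off _ _ i p≢r′ p≢q) (trans (cols i) (sym (X-p _ _ i)))

  det-equalColumns : ∀ n (M : Matrix n) {p q} → p ≢ q → (∀ i → M i p ≈ M i q) → det R n M ≈ 0#
  det-equalColumns n M {p} {q} p≢q cols with N.<-cmp (toℕ p) (toℕ q)
  ... | tri< p<q _ _ = det-equalColumnsAtDistance (toℕ q N.∸ suc (toℕ p)) n M (m<n⇒n≡1+[n∸1+m]+m p<q) cols
  ... | tri≈ _ p≡q _ = ⊥-elim (p≢q (F.toℕ-injective p≡q))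
  ... | tri> _ _ q<p = det-equalColumnsAtDistance (toℕ p N.∸ suc (toℕ q)) n M (m<n⇒n≡1+[n∸1+m]+m q<p) (sym ∘ cols)

  det-columnCombination : ∀ n m (M B : Matrix n) (k : Fin n) (d : Fin m → A) (V : Fin m → Fin n → A) →
    (∀ i j → j ≢ k → M i j ≈ B i j) → (∀ i → M i k ≈ ∑ m (λ r → d r * V r i)) →
    det R n M ≈ ∑ m (λ r → d r * det R n (replaceColumn B k (V r)))
  det-columnCombination n zero M B k d V off colₖ = det-zeroColumn n M k colₖ
  det-columnCombination n (suc m) M B k d V off colₖ = begin
    det R n M                                    ≈⟨ det-linearInColumn n M (replaceColumn B k (V zero)) B′ k (d zero) offB offB
                                                      (λ i → trans (colₖ i) (+-cong (*-congˡ (sym (replaceColumn-at B k _ i))) (sym (replaceColumn-at B k _ i)))) ⟩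
    d zero * det R n (replaceColumn B k (V zero)) + det R n B′
                                                 ≈⟨ +-congˡ (det-columnCombination n m B′ B k (d ∘ suc) (V ∘ suc) (λ i j → replaceColumn-off B k _ i) (replaceColumn-at B k _)) ⟩
    ∑ (suc m) (λ r → d r * det R n (replaceColumn B k (V r))) ∎
    where
    B′ : Matrix n
    B′ = replaceColumn B k (λ i → ∑ m (λ r → d (suc r) * V (suc r) i))
    offB : ∀ {v} i j → j ≢ k → M i j ≈ replaceColumn B k v i j
    offB i j j≢k = trans (off i j j≢k) (sym (replaceColumn-off B k _ i j≢k))

  det-addColumnCombination : ∀ n (M B : Matrix n) (k : Fin n) (d : Fin n → A) →
    (∀ i j → j ≢ k → M i j ≈ B i j) → (∀ i → M i k ≈ ∑ n (λ r → d r * B i r)) → d k ≈ 1# →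
    det R n M ≈ det R n B
  det-addColumnCombination n M B k d off colₖ dₖ≈1 = begin
    det R n M                                                   ≈⟨ det-columnCombination n n M B k d (column B) off colₖ ⟩
    ∑ n (λ r → d r * det R n (replaceColumn B k (column B r)))  ≈⟨ ∑-single n k vanish ⟩
    d k * det R n (replaceColumn B k (column B k))              ≈⟨ *-cong dₖ≈1 (det-cong n (replaceColumn-self B k)) ⟩
    1# * det R n B                                              ≈⟨ *-identityˡ _ ⟩
    det R n B                                                   ∎
    where
    vanish : ∀ r → r ≢ k → d r * det R n (replaceColumn B k (column B r)) ≈ 0#
    vanish r r≢k = trans (*-congˡ (det-equalColumns n _ (r≢k ∘ ≡.sym)
      (λ i → trans (replaceColumn-at B k _ i) (sym (replaceColumn-off B k _ i r≢k))))) (zeroʳ _)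

  splice : ∀ {n} → ℕ → Matrix n → Matrix n → Matrix n
  splice t M N i j with toℕ j N.<? t
  ... | yes _ = M i j
  ... | no _ = N i j

  splice-< : ∀ {n} t (M N : Matrix n) i {j} → toℕ j N.< t → splice t M N i j ≡ M i j
  splice-< t M N i {j} j<t with toℕ j N.<? t
  ... | yes _ = ≡.refl
  ... | no j≮t = ⊥-elim (j≮t j<t)

  splice-≮ : ∀ {n} t (M N : Matrix n) i {j} → ¬ toℕ j N.< t → splice t M N i j ≡ N i j
  splice-≮ t M N i {j} j≮t with toℕ j N.<? t
  ... | yes j<t = ⊥-elim (j≮t j<t)
  ... | no _ = ≡.refl

  -- splice t M N passes from N (t = 0) to M (t = n), changing one column per step.
  det-unitriangularColumnOperation : ∀ n (M N C : Matrix n) →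
    (∀ j → C j j ≈ 1#) → (∀ j r → toℕ j N.< toℕ r → C j r ≈ 0#) →
    (∀ i j → N i j ≈ ∑ n (λ r → C j r * M i r)) → det R n N ≈ det R n M
  det-unitriangularColumnOperation n M N C diag upper colsN = begin
    det R n N             ≈⟨ det-cong n (λ i j → reflexive (≡.sym (splice-≮ 0 M N i λ ()))) ⟩
    det R n (splice 0 M N) ≈⟨ sweep n 0 ≡.refl ⟩
    det R n M             ∎
    where
    step : ∀ t → t N.< n → det R n (splice t M N) ≈ det R n (splice (suc t) M N)
    step t t<n = det-addColumnCombination n _ _ k (C k) off colₖ (diag k)
      where
      k : Fin n
      k = F.fromℕ< t<n
      toℕk : toℕ k ≡ t
      toℕk = F.toℕ-fromℕ< t<n
      off : ∀ i j → j ≢ k → splice t M N i j ≈ splice (suc t) M N i j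
      off i j j≢k with N.<-cmp (toℕ j) t
      ... | tri< j<t _ _ = reflexive (≡.trans (splice-< t M N i j<t) (≡.sym (splice-< (suc t) M N i (N.m<n⇒m<1+n j<t))))
      ... | tri≈ _ j≡t _ = ⊥-elim (j≢k (F.toℕ-injective (≡.trans j≡t (≡.sym toℕk))))
      ... | tri> _ _ t<j = reflexive (≡.trans (splice-≮ t M N i (N.<⇒≯ t<j)) (≡.sym (splice-≮ (suc t) M N i (N.≤⇒≯ t<j))))
      term : ∀ i r → C k r * M i r ≈ C k r * splice (suc t) M N i r
      term i r with toℕ r N.≤? t
      ... | yes r≤t = *-congˡ (reflexive (≡.sym (splice-< (suc t) M N i (N.s≤s r≤t))))
      ... | no r≰t = trans (*-congʳ Ckr≈0) (trans (zeroˡ _) (sym (trans (*-congʳ Ckr≈0) (zeroˡ _))))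
        where
        Ckr≈0 : C k r ≈ 0#
        Ckr≈0 = upper k r (≡.subst (N._< toℕ r) (≡.sym toℕk) (N.≰⇒> r≰t))
      colₖ : ∀ i → splice t M N i k ≈ ∑ n (λ r → C k r * splice (suc t) M N i r)
      colₖ i = trans (reflexive (splice-≮ t M N i {k} (N.<-irrefl toℕk)))
                     (trans (colsN i k) (∑-cong n (term i)))
    sweep : ∀ d t → t N.+ d ≡ n → det R n (splice t M N) ≈ det R n M
    sweep zero t t+0≡n = det-cong n λ i j →
      reflexive (splice-< t M N i (≡.subst (toℕ j N.<_) (≡.trans (≡.sym t+0≡n) (N.+-identityʳ t)) (F.toℕ<n j)))
    sweep (suc d) t t+d≡n = trans (step t t<n) (sweep d (suc t) (≡.trans (≡.sym (N.+-suc t d)) t+d≡n))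
      where
      t<n : t N.< n
      t<n = ≡.subst (t N.<_) t+d≡n (N.m<m+n t (N.s≤s N.z≤n))

  det-expandFirstColumn : ∀ n (M : Matrix (suc n)) →
    det R (suc n) M ≈ ∑ (suc n) (λ i → sgn R (toℕ i) * (M i zero * det R n (λ r k → M (punchIn i r) (suc k))))
  det-expandFirstColumn zero M = refl
  det-expandFirstColumn (suc m) M = +-congˡ (begin
    ∑ (suc m) (λ j → sgn R (suc (toℕ j)) * (a j * det R (suc m) (minor M (suc j))))
      ≈⟨ ∑-cong (suc m) {λ j → sgn R (suc (toℕ j)) * (a j * det R (suc m) (minor M (suc j)))} expandMinor ⟩
    ∑ (suc m) (λ j → ∑ (suc m) (λ i → T i j))                 ≈⟨ ∑-comm (suc m) (suc m) (λ j i → T i j) ⟩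
    ∑ (suc m) (λ i → ∑ (suc m) (λ j → T i j))                 ≈⟨ ∑-cong (suc m) {λ i → ∑ (suc m) (λ j → T i j)} collect ⟩
    ∑ (suc m) (λ i → sgn R (suc (toℕ i)) * (b i * ∑ (suc m) (λ j → sgn R (toℕ j) * (a j * D i j)))) ∎)
    where
    a : Fin (suc m) → A
    a j = M zero (suc j)
    b : Fin (suc m) → A
    b i = M (suc i) zero
    D : Fin (suc m) → Fin (suc m) → A
    D i j = det R m (λ r k → M (suc (punchIn i r)) (suc (punchIn j k)))
    T : Fin (suc m) → Fin (suc m) → A
    T i j = sgn R (suc (toℕ j)) * (a j * (sgn R (toℕ i) * (b i * D i j)))
    pull : ∀ s x (f : Fin (suc m) → A) → s * (x * ∑ (suc m) f) ≈ ∑ (suc m) (λ i → s * (x * f i))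
    pull s x f = trans (*-congˡ (*-distribˡ-∑ (suc m) x f)) (*-distribˡ-∑ (suc m) s (λ i → x * f i))
    expandMinor : ∀ j → sgn R (suc (toℕ j)) * (a j * det R (suc m) (minor M (suc j))) ≈ ∑ (suc m) (λ i → T i j)
    expandMinor j = trans (*-congˡ (*-congˡ (det-expandFirstColumn m (minor M (suc j)))))
                          (pull (sgn R (suc (toℕ j))) (a j) (λ i → sgn R (toℕ i) * (b i * D i j)))
    exchangeSigns : ∀ sj a si b d → (- sj) * (a * (si * (b * d))) ≈ (- si) * (b * (sj * (a * d)))
    exchangeSigns = solve 5 (λ sj a si b d → (:- sj) :* (a :* (si :* (b :* d))) := (:- si) :* (b :* (sj :* (a :* d)))) refl
    collect : ∀ i → ∑ (suc m) (λ j → T i j) ≈ sgn R (suc (toℕ i)) * (b i * ∑ (suc m) (λ j → sgn R (toℕ j) * (a j * D i j)))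
    collect i = trans (∑-cong (suc m) {T i} (λ j → exchangeSigns (sgn R (toℕ j)) (a j) (sgn R (toℕ i)) (b i) (D i j)))
                      (sym (pull (sgn R (suc (toℕ i))) (b i) (λ j → sgn R (toℕ j) * (a j * D i j))))

  det-transpose : ∀ n (M : Matrix n) → det R n (λ i j → M j i) ≈ det R n M
  det-transpose zero M = refl
  det-transpose (suc n) M = trans
    (∑-cong (suc n) {laplaceTerm (λ i j → M j i)} (λ j → *-congˡ (*-congˡ (det-transpose n (λ r k → M (punchIn j r) (suc k))))))
    (sym (det-expandFirstColumn n M))

  det-unitriangularRowOperation : ∀ n (M N C : Matrix n) →
    (∀ i → C i i ≈ 1#) → (∀ i r → toℕ i N.< toℕ r → C i r ≈ 0#) →
    (∀ i j → N i j ≈ ∑ n (λ r → C i r * M r j)) → det R n N ≈ det R n M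
  det-unitriangularRowOperation n M N C diag upper rowsN = begin
    det R n N                     ≈⟨ det-transpose n N ⟨
    det R n (λ i j → N j i)       ≈⟨ det-unitriangularColumnOperation n (λ i j → M j i) (λ i j → N j i) C diag upper (λ i j → rowsN j i) ⟩
    det R n (λ i j → M j i)       ≈⟨ det-transpose n M ⟩
    det R n M                     ∎

module PowerSeries {c ℓ} (R : CommutativeRing c ℓ) where
  open CommutativeRing R renaming (Carrier to A) hiding (zero)
  open IntegerCoefficients R using (solve; _:+_; _:*_; :-_; _:-_; _:=_; con)
  open Determinant R using (∑; ∑-cong; ∑-distrib-+; *-distribˡ-∑; ∑-zero; ∑-last)
  open import Relation.Binary.Reasoning.Setoid setoid

  Series : Set c
  Series = ℕ → A

  const : A → Series
  const x zero = x
  const x (suc k) = 0#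

  shift₂ : Series → Series
  shift₂ f zero = 0#
  shift₂ f (suc zero) = 0#
  shift₂ f (suc (suc k)) = f k

  infix 4 _≋_
  _≋_ : Series → Series → Set ℓ
  f ≋ g = ∀ k → f k ≈ g k

  shift₂-cong : ∀ {f g} → f ≋ g → shift₂ f ≋ shift₂ g
  shift₂-cong f≋g zero = refl
  shift₂-cong f≋g (suc zero) = refl
  shift₂-cong f≋g (suc (suc k)) = f≋g k

  conv-cong : ∀ {f f′ g g′} → f ≋ f′ → g ≋ g′ → conv R f g ≋ conv R f′ g′
  conv-cong {f} {g = g} f≋f′ g≋g′ n =
    ∑-cong (suc n) {λ k → f (toℕ k) * g (n N.∸ toℕ k)} λ k → *-cong (f≋f′ (toℕ k)) (g≋g′ (n N.∸ toℕ k))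

  conv-distribʳ-+ : ∀ f g w → conv R (λ k → f k + g k) w ≋ λ n → conv R f w n + conv R g w n
  conv-distribʳ-+ f g w n = trans
    (∑-cong (suc n) {λ k → (f (toℕ k) + g (toℕ k)) * w (n N.∸ toℕ k)} (λ k → distribʳ _ _ _))
    (∑-distrib-+ (suc n) (λ k → f (toℕ k) * w (n N.∸ toℕ k)) (λ k → g (toℕ k) * w (n N.∸ toℕ k)))

  conv-scaleˡ : ∀ x f w → conv R (λ k → x * f k) w ≋ λ n → x * conv R f w n
  conv-scaleˡ x f w n = trans
    (∑-cong (suc n) {λ k → (x * f (toℕ k)) * w (n N.∸ toℕ k)} (λ k → *-assoc _ _ _))
    (sym (*-distribˡ-∑ (suc n) x (λ k → f (toℕ k) * w (n N.∸ toℕ k))))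

  conv-constˡ : ∀ x w → conv R (const x) w ≋ λ n → x * w n
  conv-constˡ x w n = trans (+-congˡ (∑-zero n (λ k → zeroˡ _))) (+-identityʳ _)

  conv-shift₂ˡ : ∀ f w → conv R (shift₂ f) w ≋ shift₂ (conv R f w)
  conv-shift₂ˡ f w zero = trans (+-identityʳ _) (zeroˡ _)
  conv-shift₂ˡ f w (suc zero) = trans (+-cong (zeroˡ _) (trans (+-identityʳ _) (zeroˡ _))) (+-identityʳ _)
  conv-shift₂ˡ f w (suc (suc k)) = trans (+-cong (zeroˡ _) (trans (+-congʳ (zeroˡ _)) (+-identityˡ _))) (+-identityˡ _)

  conv-assoc : ∀ f g w → conv R (conv R f g) w ≋ conv R f (conv R g w)
  conv-assoc f g w zero = solve 3 (λ a b c → (a :* b :+ con 0ℤ) :* c :+ con 0ℤ := a :* (b :* c :+ con 0ℤ) :+ con 0ℤ) refl (f 0) (g 0) (w 0)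
  conv-assoc f g w (suc n) = begin
    conv R f g 0 * w (suc n) + ∑ (suc n) (λ m → (f 0 * g (suc (toℕ m)) + conv R (f ∘ suc) g (toℕ m)) * w (n N.∸ toℕ m))
      ≈⟨ +-congˡ (∑-cong (suc n) {λ m → (f 0 * g (suc (toℕ m)) + conv R (f ∘ suc) g (toℕ m)) * w (n N.∸ toℕ m)}
           (λ m → solve 4 (λ a b c d → (a :* b :+ c) :* d := a :* (b :* d) :+ c :* d) refl (f 0) (g (suc (toℕ m))) _ (w (n N.∸ toℕ m)))) ⟩
    conv R f g 0 * w (suc n) + ∑ (suc n) (λ m → f 0 * (g (suc (toℕ m)) * w (n N.∸ toℕ m)) + conv R (f ∘ suc) g (toℕ m) * w (n N.∸ toℕ m))
      ≈⟨ +-congˡ (trans (∑-distrib-+ (suc n) (λ m → f 0 * (g (suc (toℕ m)) * w (n N.∸ toℕ m))) (λ m → conv R (f ∘ suc) g (toℕ m) * w (n N.∸ toℕ m)))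
                        (+-congʳ (sym (*-distribˡ-∑ (suc n) (f 0) (λ m → g (suc (toℕ m)) * w (n N.∸ toℕ m)))))) ⟩
    (f 0 * g 0 + 0#) * w (suc n) + (f 0 * S + conv R (conv R (f ∘ suc) g) w n)
      ≈⟨ solve 5 (λ a b c s t → (a :* b :+ con 0ℤ) :* c :+ (a :* s :+ t) := a :* (b :* c :+ s) :+ t) refl (f 0) (g 0) (w (suc n)) S _ ⟩
    f 0 * conv R g w (suc n) + conv R (conv R (f ∘ suc) g) w n
      ≈⟨ +-congˡ (conv-assoc (f ∘ suc) g w n) ⟩
    f 0 * conv R g w (suc n) + conv R (f ∘ suc) (conv R g w) n ∎
    where
    S : A
    S = ∑ (suc n) (λ m → g (suc (toℕ m)) * w (n N.∸ toℕ m))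

  conv-splitLast : ∀ f w n → conv R f w n ≈ ∑ n (λ k → f (toℕ k) * w (n N.∸ toℕ k)) + f n * w 0
  conv-splitLast f w zero = +-comm _ _
  conv-splitLast f w (suc n) = trans (∑-last (suc n) (λ k → f (toℕ k) * w (suc n N.∸ toℕ k)))
    (+-cong (∑-cong (suc n) (λ k → reflexive (≡.cong (λ i → f i * w (suc n N.∸ i)) (F.toℕ-inject₁ k))))
            (reflexive (≡.cong₂ (λ i j → f i * w j) (F.toℕ-fromℕ (suc n)) (≡.trans (≡.cong (suc n N.∸_) (F.toℕ-fromℕ (suc n))) (N.n∸n≡0 (suc n))))))

  conv-cancelʳ : ∀ f g w → w 0 ≈ 1# → conv R f w ≋ conv R g w → f ≋ g
  conv-cancelʳ f g w w₀≈1 fw≋gw = <-rec (λ n → f n ≈ g n) step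
    where
    step : ∀ n → (∀ {m} → m N.< n → f m ≈ g m) → f n ≈ g n
    step n below = begin
      f n                     ≈⟨ *-identityʳ _ ⟨
      f n * 1#                ≈⟨ *-congˡ w₀≈1 ⟨
      f n * w 0               ≈⟨ +-cancelˡ _ _ _ lastTerms ⟩
      g n * w 0               ≈⟨ *-congˡ w₀≈1 ⟩
      g n * 1#                ≈⟨ *-identityʳ _ ⟩
      g n                     ∎
      where
      open import Algebra.Properties.Group +-group using () renaming (∙-cancelˡ to +-cancelˡ)
      initial : ∑ n (λ k → f (toℕ k) * w (n N.∸ toℕ k)) ≈ ∑ n (λ k → g (toℕ k) * w (n N.∸ toℕ k))
      initial = ∑-cong n (λ k → *-congʳ (below (F.toℕ<n k)))
      lastTerms : ∑ n (λ k → f (toℕ k) * w (n N.∸ toℕ k)) + f n * w 0 ≈ ∑ n (λ k → f (toℕ k) * w (n N.∸ toℕ k)) + g n * w 0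
      lastTerms = trans (sym (conv-splitLast f w n)) (trans (fw≋gw n) (trans (conv-splitLast g w n) (+-congʳ (sym initial))))

  module _ (w : Series) where

    -- approx n agrees with 1 / w at indices ≤ n (when w₀ = 1); the next coefficient solves
    -- (approx n · w)ₙ₊₁ = 0.
    private
      approx : ℕ → Series
      approx zero k = 1#
      approx (suc n) k with k N.≤? n
      ... | yes _ = approx n k
      ... | no _ = - ∑ (suc n) (λ j → approx n (toℕ j) * w (suc n N.∸ toℕ j))

    reciprocal : Series
    reciprocal k = approx k k

    private
      approx-stable : ∀ n k → k N.≤ n → approx n k ≡ reciprocal k
      approx-stable zero zero _ = ≡.refl
      approx-stable (suc n) k k≤1+n with k N.≤? n
      ... | yes k≤n = approx-stable n k k≤n
      ... | no k≰n with N.m≤n⇒m<n∨m≡n k≤1+n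
      ...   | inj₁ k<1+n = ⊥-elim (k≰n (N.s≤s⁻¹ k<1+n))
      ...   | inj₂ ≡.refl with suc n N.≤? n
      ...     | yes 1+n≤n = ⊥-elim (N.1+n≰n 1+n≤n)
      ...     | no _ = ≡.refl

    reciprocal-suc : ∀ n → reciprocal (suc n) ≈ - ∑ (suc n) (λ j → reciprocal (toℕ j) * w (suc n N.∸ toℕ j))
    reciprocal-suc n with suc n N.≤? n
    ... | yes 1+n≤n = ⊥-elim (N.1+n≰n 1+n≤n)
    ... | no _ = -‿cong (∑-cong (suc n) {λ j → approx n (toℕ j) * w (suc n N.∸ toℕ j)} λ j → *-congʳ (reflexive (approx-stable n (toℕ j) (N.s≤s⁻¹ (F.toℕ<n j)))))

    conv-reciprocal : w 0 ≈ 1# → conv R reciprocal w ≋ const 1#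
    conv-reciprocal w₀≈1 zero = trans (+-identityʳ _) (trans (*-congˡ w₀≈1) (*-identityʳ 1#))
    conv-reciprocal w₀≈1 (suc n) = begin
      conv R reciprocal w (suc n)          ≈⟨ conv-splitLast reciprocal w (suc n) ⟩
      S + reciprocal (suc n) * w 0         ≈⟨ +-congˡ (*-cong (reciprocal-suc n) w₀≈1) ⟩
      S + (- S) * 1#                       ≈⟨ solve 1 (λ s → s :+ (:- s) :* con 1ℤ := con 0ℤ) refl S ⟩
      0#                                   ∎
      where
      S : A
      S = ∑ (suc n) (λ k → reciprocal (toℕ k) * w (suc n N.∸ toℕ k))

module HankelOfQuotient {c ℓ} (R : CommutativeRing c ℓ) where
  open CommutativeRing R renaming (Carrier to A) hiding (zero)
  open IntegerCoefficients R using (solve; _:+_; _:*_; :-_; _:-_; _:=_; con)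
  open Determinant R
  open PowerSeries R
  open import Relation.Binary.Reasoning.Setoid setoid

  truncate : ℕ → ℕ → A → A
  truncate zero j x = x
  truncate (suc r) zero x = 0#
  truncate (suc r) (suc j) x = truncate r j x

  truncate-≤ : ∀ r j x → r N.≤ j → truncate r j x ≡ x
  truncate-≤ zero j x _ = ≡.refl
  truncate-≤ (suc r) (suc j) x r≤j = truncate-≤ r j x (N.s≤s⁻¹ r≤j)

  truncate-> : ∀ r j x → j N.< r → truncate r j x ≡ 0#
  truncate-> (suc r) zero x _ = ≡.refl
  truncate-> (suc r) (suc j) x j<r = truncate-> r j x (N.s<s⁻¹ j<r)

  toeplitz : ∀ {n} → Series → Matrix n
  toeplitz u j r = truncate (toℕ r) (toℕ j) (u (toℕ j N.∸ toℕ r))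

  toeplitz-diagonal : ∀ {n} u → u 0 ≈ 1# → (j : Fin n) → toeplitz u j j ≈ 1#
  toeplitz-diagonal u u₀≈1 j =
    trans (reflexive (≡.trans (truncate-≤ (toℕ j) (toℕ j) _ N.≤-refl) (≡.cong u (N.n∸n≡0 (toℕ j))))) u₀≈1

  toeplitz-upper : ∀ {n} u (j r : Fin n) → toℕ j N.< toℕ r → toeplitz u j r ≈ 0#
  toeplitz-upper u j r j<r = reflexive (truncate-> (toℕ r) (toℕ j) _ j<r)

  conv≈∑toeplitz : ∀ n g u (j : Fin n) → conv R g u (toℕ j) ≈ ∑ n (λ r → toeplitz u j r * g (toℕ r))
  conv≈∑toeplitz (suc n) g u zero =
    trans (+-identityʳ _) (trans (*-comm _ _) (sym (trans (+-congˡ (∑-zero n (λ _ → zeroˡ _))) (+-identityʳ _))))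
  conv≈∑toeplitz (suc n) g u (suc j) = +-cong (*-comm _ _) (conv≈∑toeplitz n (g ∘ suc) u j)

  module _ (f u : Series) (u₀≈1 : u 0 ≈ 1#) where

    -- With L the Toeplitz matrix of u and H the Hankel matrix of f: Z = H Lᵀ and W = L H Lᵀ.
    -- Row 0 of W is f · u, and W (i+1) (j+1) = h₀ · (− u (i+j+2)) when f · u = h₀.
    private
      h : Series
      h = conv R f u

      Z : ℕ → Series
      Z p = conv R (λ k → f (p N.+ k)) u

      W : ℕ → Series
      W i j = conv R (λ p → Z p j) u i

      det-Z : ∀ n → det R n (λ i j → Z (toℕ i) (toℕ j)) ≈ Hankel R f n
      det-Z n = det-unitriangularColumnOperation n _ _ (toeplitz u) (toeplitz-diagonal u u₀≈1) (toeplitz-upper u)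
        (λ i j → conv≈∑toeplitz n (λ k → f (toℕ i N.+ k)) u j)

      det-W : ∀ n → det R n (λ i j → W (toℕ i) (toℕ j)) ≈ det R n (λ i j → Z (toℕ i) (toℕ j))
      det-W n = det-unitriangularRowOperation n _ _ (toeplitz u) (toeplitz-diagonal u u₀≈1) (toeplitz-upper u)
        (λ i j → conv≈∑toeplitz n (λ p → Z p (toℕ j)) u i)

      W-row₀ : ∀ j → W 0 j ≈ h j
      W-row₀ j = trans (+-identityʳ _) (trans (*-congˡ u₀≈1) (*-identityʳ _))

      Z-suc : ∀ p j → Z p (suc j) ≈ f p * u (suc j) + Z (suc p) j
      Z-suc p j = +-cong (*-congʳ (reflexive (≡.cong f (N.+-identityʳ p))))
        (∑-cong (suc j) {λ k → f (p N.+ suc (toℕ k)) * u (j N.∸ toℕ k)} (λ k → *-congʳ (reflexive (≡.cong f (N.+-suc p (toℕ k))))))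

      W-suc : ∀ i j → W (suc i) j ≈ W i (suc j) + (u (suc i) * h j - u (suc j) * h i)
      W-suc i j = begin
        Z 0 j * u (suc i) + ∑ (suc i) (λ p → Z (suc (toℕ p)) j * v p)
          ≈⟨ +-congˡ (∑-cong (suc i) {λ p → Z (suc (toℕ p)) j * v p} shiftRow) ⟩
        Z 0 j * u (suc i) + ∑ (suc i) (λ p → Z (toℕ p) (suc j) * v p + (- u (suc j)) * (f (toℕ p) * v p))
          ≈⟨ +-congˡ (trans (∑-distrib-+ (suc i) (λ p → Z (toℕ p) (suc j) * v p) (λ p → (- u (suc j)) * (f (toℕ p) * v p)))
                            (+-congˡ (sym (*-distribˡ-∑ (suc i) (- u (suc j)) (λ p → f (toℕ p) * v p))))) ⟩
        h j * u (suc i) + (W i (suc j) + (- u (suc j)) * h i)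
          ≈⟨ solve 5 (λ hj ui W uj hi → hj :* ui :+ (W :+ (:- uj) :* hi) := W :+ (ui :* hj :- uj :* hi)) refl (h j) (u (suc i)) (W i (suc j)) (u (suc j)) (h i) ⟩
        W i (suc j) + (u (suc i) * h j - u (suc j) * h i) ∎
        where
        v : Fin (suc i) → A
        v p = u (i N.∸ toℕ p)
        shiftRow : ∀ p → Z (suc (toℕ p)) j * v p ≈ Z (toℕ p) (suc j) * v p + (- u (suc j)) * (f (toℕ p) * v p)
        shiftRow p = begin
          Z (suc (toℕ p)) j * v p
            ≈⟨ *-congʳ (solve 2 (λ z a → z := (a :+ z) :- a) refl (Z (suc (toℕ p)) j) (f (toℕ p) * u (suc j))) ⟩
          ((f (toℕ p) * u (suc j) + Z (suc (toℕ p)) j) - f (toℕ p) * u (suc j)) * v p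
            ≈⟨ *-congʳ (+-congʳ (Z-suc (toℕ p) j)) ⟨
          (Z (toℕ p) (suc j) - f (toℕ p) * u (suc j)) * v p
            ≈⟨ solve 4 (λ z a b w → (z :- a :* b) :* w := z :* w :+ (:- b) :* (a :* w)) refl (Z (toℕ p) (suc j)) (f (toℕ p)) (u (suc j)) (v p) ⟩
          Z (toℕ p) (suc j) * v p + (- u (suc j)) * (f (toℕ p) * v p) ∎

    hankel-quotient : ∀ h₀ → conv R f u ≋ const h₀ → ∀ m →
      Hankel R f (suc m) ≈ pow R h₀ (suc m) * Hankel R (λ k → - u (suc (suc k))) m
    hankel-quotient h₀ h≋h₀ m = begin
      Hankel R f (suc m)                                           ≈⟨ trans (det-W (suc m)) (det-Z (suc m)) ⟨
      det R (suc m) (λ i j → W (toℕ i) (toℕ j))                   ≈⟨ det-firstRowSingleEntry m (λ i j → W (toℕ i) (toℕ j)) row₀ ⟩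
      W 0 0 * det R m (λ i k → W (suc (toℕ i)) (suc (toℕ k)))
        ≈⟨ *-cong (trans (W-row₀ 0) (h≋h₀ 0)) (det-cong m (λ i k → W-inner (toℕ i) (toℕ k))) ⟩
      h₀ * det R m (λ i k → h₀ * - u (suc (suc (toℕ i N.+ toℕ k)))) ≈⟨ *-congˡ (det-scale m h₀ _) ⟩
      h₀ * (pow R h₀ m * Hankel R (λ k → - u (suc (suc k))) m)    ≈⟨ *-assoc _ _ _ ⟨
      pow R h₀ (suc m) * Hankel R (λ k → - u (suc (suc k))) m     ∎
      where
      row₀ : ∀ j → j ≢ zero → W 0 (toℕ j) ≈ 0#
      row₀ zero 0≢0 = ⊥-elim (0≢0 ≡.refl)
      row₀ (suc j) _ = trans (W-row₀ _) (h≋h₀ _)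
      vanish : ∀ x k → u x * h (suc k) ≈ 0#
      vanish x k = trans (*-congˡ (h≋h₀ (suc k))) (zeroʳ _)
      W-inner : ∀ i j → W (suc i) (suc j) ≈ h₀ * - u (suc (suc (i N.+ j)))
      W-inner zero j = begin
        W 1 (suc j)                                                ≈⟨ W-suc 0 (suc j) ⟩
        W 0 (suc (suc j)) + (u 1 * h (suc j) - u (suc (suc j)) * h 0)
          ≈⟨ +-cong (trans (W-row₀ _) (h≋h₀ _)) (+-cong (vanish 1 j) (-‿cong (*-congˡ (h≋h₀ 0)))) ⟩
        0# + (0# - u (suc (suc j)) * h₀)                           ≈⟨ solve 2 (λ x y → con 0ℤ :+ (con 0ℤ :- x :* y) := y :* (:- x)) refl _ h₀ ⟩
        h₀ * - u (suc (suc j))                                     ∎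
      W-inner (suc i) j = begin
        W (suc (suc i)) (suc j)                                    ≈⟨ W-suc (suc i) (suc j) ⟩
        W (suc i) (suc (suc j)) + (u (suc (suc i)) * h (suc j) - u (suc (suc j)) * h (suc i))
          ≈⟨ +-cong (W-inner i (suc j)) (+-cong (vanish _ j) (-‿cong (vanish _ i))) ⟩
        h₀ * - u (suc (suc (i N.+ suc j))) + (0# - 0#)             ≈⟨ trans (+-congˡ (-‿inverseʳ 0#)) (+-identityʳ _) ⟩
        h₀ * - u (suc (suc (i N.+ suc j)))                         ≡⟨ ≡.cong (λ k → h₀ * - u (suc (suc k))) (N.+-suc i j) ⟩
        h₀ * - u (suc (suc (suc i N.+ j)))                         ∎

module PowerLaws {c ℓ} (R : CommutativeRing c ℓ) where
  open CommutativeRing R renaming (Carrier to A) hiding (zero)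
  open IntegerCoefficients R using (solve; _:+_; _:*_; :-_; _:-_; _:=_; con)
  open import Algebra.Properties.Ring ring using (-‿involutive)

  pow-cong : ∀ {x y} n → x ≈ y → pow R x n ≈ pow R y n
  pow-cong zero _ = refl
  pow-cong (suc n) x≈y = *-cong x≈y (pow-cong n x≈y)

  pow-+ : ∀ x m n → pow R x (m N.+ n) ≈ pow R x m * pow R x n
  pow-+ x zero n = sym (*-identityˡ _)
  pow-+ x (suc m) n = trans (*-congˡ (pow-+ x m n)) (sym (*-assoc _ _ _))

  pow-* : ∀ x y n → pow R (x * y) n ≈ pow R x n * pow R y n
  pow-* x y zero = sym (*-identityˡ 1#)
  pow-* x y (suc n) = trans (*-congˡ (pow-* x y n))
    (solve 4 (λ x y p q → (x :* y) :* (p :* q) := (x :* p) :* (y :* q)) refl x y (pow R x n) (pow R y n))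

  pow-1# : ∀ n → pow R 1# n ≈ 1#
  pow-1# zero = refl
  pow-1# (suc n) = trans (*-identityˡ _) (pow-1# n)

  pow-neg : ∀ x n → pow R (- x) n ≈ sgn R n * pow R x n
  pow-neg x zero = sym (*-identityˡ 1#)
  pow-neg x (suc n) = trans (*-congˡ (pow-neg x n))
    (solve 3 (λ x s p → (:- x) :* (s :* p) := (:- s) :* (x :* p)) refl x (sgn R n) (pow R x n))

  sgn-even : ∀ n → sgn R (2 N.* n) ≈ 1#
  sgn-even zero = refl
  sgn-even (suc n) = trans (reflexive (≡.cong (sgn R) (N.*-suc 2 n))) (trans (-‿involutive _) (sgn-even n))

  pow-neg-even : ∀ x n → pow R (- x) (2 N.* n) ≈ pow R x (2 N.* n)
  pow-neg-even x n = trans (pow-neg x (2 N.* n)) (trans (*-congʳ (sgn-even n)) (*-identityˡ _))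

  pow-neg-odd : ∀ x n → pow R (- x) (suc (2 N.* n)) ≈ - pow R x (suc (2 N.* n))
  pow-neg-odd x n = trans (pow-neg x (suc (2 N.* n)))
    (trans (*-congʳ (-‿cong (sgn-even n))) (solve 1 (λ p → (:- con 1ℤ) :* p := :- p) refl _))

module HankelG24 {c ℓ} (R : CommutativeRing c ℓ) where
  open CommutativeRing R renaming (Carrier to A) hiding (zero)
  open IntegerCoefficients R using (solve; _:+_; _:*_; :-_; _:-_; _:=_; con)
  open import Algebra.Properties.Ring ring using (-‿distribˡ-*; -0#≈0#)
  open Determinant R using (det-cong; det-scale)
  open PowerSeries R
  open HankelOfQuotient R using (hankel-quotient)
  open PowerLaws R
  open import Relation.Binary.Reasoning.Setoid setoid

  module Solution (a b₁ b₂ cc : A) (G : ℕ → A) (isG : IsG24 R a b₁ b₂ cc G) where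
    κ : A
    κ = a * cc

    D : A → Series
    D β = denom R b₁ β cc G

    -- F β = − (D β − 1 − b₁x) / x² = − β − c x² G
    F : A → Series
    F β k = - D β (suc (suc k))

    -- By Q-shift, Q β m = β₀ ⋯ βₘ₋₁ for the chain β₀ = β, βₖ₊₁ = b₂ + κ / βₖ.
    Q : A → ℕ → A
    Q β zero = 1#
    Q β (suc zero) = β
    Q β (suc (suc j)) = b₂ * Q β (suc j) + κ * Q β j

    G-equation : conv R G (D b₂) ≋ const a
    G-equation zero = proj₁ isG
    G-equation (suc n) = proj₂ isG n

    G₀≈a : G 0 ≈ a
    G₀≈a = trans (sym (trans (+-identityʳ _) (*-identityʳ _))) (G-equation 0)

    hankel-G : ∀ m → Hankel R G (suc m) ≈ pow R a (suc m) * Hankel R (F b₂) m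
    hankel-G = hankel-quotient G (D b₂) refl a G-equation

    hankel-F-one : ∀ β → Hankel R (F β) 1 ≈ - β
    hankel-F-one β = solve 1 (λ b → con 1ℤ :* ((:- b) :* con 1ℤ) :+ con 0ℤ := :- b) refl β

    -- computed directly, so that hankel-F-even never inverts the last β of the chain
    hankel-F-two : ∀ β → Hankel R (F β) 2 ≈ κ * β
    hankel-F-two β = trans
      (solve 3 (λ b c g → con 1ℤ :* ((:- b) :* (con 1ℤ :* ((:- (c :* g)) :* con 1ℤ) :+ con 0ℤ))
                          :+ ((:- con 1ℤ) :* ((:- con 0ℤ) :* (con 1ℤ :* ((:- con 0ℤ) :* con 1ℤ) :+ con 0ℤ)) :+ con 0ℤ)
                          := (c :* g) :* b) refl β cc (G 0))
      (*-congʳ (trans (*-congˡ G₀≈a) (*-comm cc a)))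

    Q-shift : ∀ β e → β * e ≈ κ → ∀ j → Q β (suc j) ≈ β * Q (b₂ + e) j
    Q-shift β e βe≈κ zero = sym (*-identityʳ β)
    Q-shift β e βe≈κ (suc zero) = begin
      b₂ * β + κ * 1#                ≈⟨ solve 4 (λ b₂ b k e → b₂ :* b :+ k :* con 1ℤ := b :* (b₂ :+ e) :+ (k :- b :* e)) refl b₂ β κ e ⟩
      β * (b₂ + e) + (κ - β * e)     ≈⟨ +-congˡ (trans (+-congˡ (-‿cong βe≈κ)) (-‿inverseʳ κ)) ⟩
      β * (b₂ + e) + 0#              ≈⟨ +-identityʳ _ ⟩
      β * (b₂ + e)                   ∎
    Q-shift β e βe≈κ (suc (suc j)) = begin
      b₂ * Q β (suc (suc j)) + κ * Q β (suc j)
        ≈⟨ +-cong (*-congˡ (Q-shift β e βe≈κ (suc j))) (*-congˡ (Q-shift β e βe≈κ j)) ⟩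
      b₂ * (β * Q (b₂ + e) (suc j)) + κ * (β * Q (b₂ + e) j)
        ≈⟨ solve 5 (λ b₂ b k x y → b₂ :* (b :* x) :+ k :* (b :* y) := b :* (b₂ :* x :+ k :* y)) refl b₂ β κ _ _ ⟩
      β * Q (b₂ + e) (suc (suc j)) ∎

    -- u = 1 − e x² / w is chosen so that F β · u = − β (checked after multiplying by w); then
    -- hankel-quotient applies to F β with h₀ = − β, and to 1 / w with h₀ = 1.
    module Step (β β⁻¹ : A) (ββ⁻¹≈1 : β * β⁻¹ ≈ 1#) where

      e : A
      e = κ * β⁻¹

      βe≈κ : β * e ≈ κ
      βe≈κ = trans (solve 3 (λ b k i → b :* (k :* i) := k :* (b :* i)) refl β κ β⁻¹) (trans (*-congˡ ββ⁻¹≈1) (*-identityʳ κ))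

      w : Series
      w = D (b₂ + e)

      q : Series
      q = reciprocal w

      u : Series
      u k = const 1# k - e * shift₂ q k

      x² : Series
      x² = shift₂ (const 1#)

      w≋D+ex² : w ≋ λ k → D b₂ k + e * x² k
      w≋D+ex² zero = sym (trans (+-congˡ (zeroʳ _)) (+-identityʳ _))
      w≋D+ex² (suc zero) = sym (trans (+-congˡ (zeroʳ _)) (+-identityʳ _))
      w≋D+ex² (suc (suc zero)) = +-congˡ (sym (*-identityʳ _))
      w≋D+ex² (suc (suc (suc zero))) = sym (trans (+-congˡ (zeroʳ _)) (+-identityʳ _))
      w≋D+ex² (suc (suc (suc (suc k)))) = sym (trans (+-congˡ (zeroʳ _)) (+-identityʳ _))

      F≋-β-cx²G : F β ≋ λ k → (- β) * const 1# k + (- cc) * shift₂ G k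
      F≋-β-cx²G zero = sym (trans (+-cong (*-identityʳ _) (zeroʳ _)) (+-identityʳ _))
      F≋-β-cx²G (suc zero) = sym (trans (+-cong (zeroʳ _) (zeroʳ _)) (trans (+-identityʳ _) (sym -0#≈0#)))
      F≋-β-cx²G (suc (suc k)) = sym (trans (+-congʳ (zeroʳ _)) (trans (+-identityˡ _) (solve 2 (λ c g → (:- c) :* g := :- (c :* g)) refl cc (G k))))

      uw≋D : conv R u w ≋ D b₂
      uw≋D k = begin
        conv R u w k
          ≈⟨ conv-cong {u} {λ j → const 1# j + (- e) * shift₂ q j} {w} (λ j → +-congˡ (-‿distribˡ-* e (shift₂ q j))) (λ _ → refl) k ⟩
        conv R (λ j → const 1# j + (- e) * shift₂ q j) w k
          ≈⟨ trans (conv-distribʳ-+ (const 1#) (λ j → (- e) * shift₂ q j) w k) (+-cong (conv-constˡ 1# w k) (conv-scaleˡ (- e) (shift₂ q) w k)) ⟩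
        1# * w k + (- e) * conv R (shift₂ q) w k
          ≈⟨ +-cong (trans (*-identityˡ _) (w≋D+ex² k)) (*-congˡ (trans (conv-shift₂ˡ q w k) (shift₂-cong (conv-reciprocal w refl) k))) ⟩
        (D b₂ k + e * x² k) + (- e) * x² k
          ≈⟨ solve 3 (λ d e s → (d :+ e :* s) :+ (:- e) :* s := d) refl (D b₂ k) e (x² k) ⟩
        D b₂ k ∎

      Fuw≋-βw : conv R (conv R (F β) u) w ≋ conv R (const (- β)) w
      Fuw≋-βw n = begin
        conv R (conv R (F β) u) w n
          ≈⟨ trans (conv-assoc (F β) u w n) (conv-cong F≋-β-cx²G uw≋D n) ⟩
        conv R (λ k → (- β) * const 1# k + (- cc) * shift₂ G k) (D b₂) n
          ≈⟨ trans (conv-distribʳ-+ (λ k → (- β) * const 1# k) (λ k → (- cc) * shift₂ G k) (D b₂) n) (+-cong (conv-scaleˡ (- β) (const 1#) (D b₂) n) (conv-scaleˡ (- cc) (shift₂ G) (D b₂) n)) ⟩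
        (- β) * conv R (const 1#) (D b₂) n + (- cc) * conv R (shift₂ G) (D b₂) n
          ≈⟨ +-cong (*-congˡ (conv-constˡ 1# (D b₂) n)) (*-congˡ (trans (conv-shift₂ˡ G (D b₂) n) (shift₂-cong G-equation n))) ⟩
        (- β) * (1# * D b₂ n) + (- cc) * shift₂ (const a) n
          ≈⟨ +-congˡ (*-congˡ (ax² n)) ⟩
        (- β) * (1# * D b₂ n) + (- cc) * (a * x² n)
          ≈⟨ solve 6 (λ b d c a s e → (:- b) :* (con 1ℤ :* d) :+ (:- c) :* (a :* s) := (:- b) :* (d :+ e :* s) :+ (b :* e :- a :* c) :* s) refl β (D b₂ n) cc a (x² n) e ⟩
        (- β) * (D b₂ n + e * x² n) + (β * e - κ) * x² n
          ≈⟨ +-cong (*-congˡ (sym (w≋D+ex² n))) (trans (*-congʳ (trans (+-congʳ βe≈κ) (-‿inverseʳ κ))) (zeroˡ _)) ⟩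
        (- β) * w n + 0#
          ≈⟨ trans (+-identityʳ _) (sym (conv-constˡ (- β) w n)) ⟩
        conv R (const (- β)) w n ∎
        where
        ax² : ∀ k → shift₂ (const a) k ≈ a * x² k
        ax² zero = sym (zeroʳ a)
        ax² (suc zero) = sym (zeroʳ a)
        ax² (suc (suc zero)) = sym (*-identityʳ a)
        ax² (suc (suc (suc k))) = sym (zeroʳ a)

      Fu≋-β : conv R (F β) u ≋ const (- β)
      Fu≋-β = conv-cancelʳ (conv R (F β) u) (const (- β)) w refl Fuw≋-βw

      u₀≈1 : u 0 ≈ 1#
      u₀≈1 = trans (+-congˡ (trans (-‿cong (zeroʳ e)) -0#≈0#)) (+-identityʳ 1#)

      hankel-F-step : ∀ m → Hankel R (F β) (suc (suc m)) ≈ (- β) * (pow R (- κ) (suc m) * Hankel R (F (b₂ + e)) m)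
      hankel-F-step m = begin
        Hankel R (F β) (suc (suc m))
          ≈⟨ hankel-quotient (F β) u u₀≈1 (- β) Fu≋-β (suc m) ⟩
        pow R (- β) (suc (suc m)) * Hankel R (λ k → - u (suc (suc k))) (suc m)
          ≈⟨ *-congˡ (det-cong (suc m) (λ i j → solve 2 (λ e q → :- (con 0ℤ :- e :* q) := e :* q) refl e (q (toℕ i N.+ toℕ j)))) ⟩
        pow R (- β) (suc (suc m)) * det R (suc m) (λ i j → e * q (toℕ i N.+ toℕ j))
          ≈⟨ *-congˡ (det-scale (suc m) e (λ i j → q (toℕ i N.+ toℕ j))) ⟩
        pow R (- β) (suc (suc m)) * (pow R e (suc m) * Hankel R q (suc m))
          ≈⟨ *-congˡ (*-congˡ (hankel-quotient q w refl 1# (conv-reciprocal w refl) m)) ⟩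
        pow R (- β) (suc (suc m)) * (pow R e (suc m) * (pow R 1# (suc m) * Hankel R (F (b₂ + e)) m))
          ≈⟨ *-congˡ (*-congˡ (trans (*-congʳ (pow-1# (suc m))) (*-identityˡ _))) ⟩
        ((- β) * pow R (- β) (suc m)) * (pow R e (suc m) * Hankel R (F (b₂ + e)) m)
          ≈⟨ solve 4 (λ b p x h → (b :* p) :* (x :* h) := b :* ((p :* x) :* h)) refl (- β) _ _ _ ⟩
        (- β) * ((pow R (- β) (suc m) * pow R e (suc m)) * Hankel R (F (b₂ + e)) m)
          ≈⟨ *-congˡ (*-congʳ (trans (sym (pow-* (- β) e (suc m))) (pow-cong (suc m) -βe≈-κ))) ⟩
        (- β) * (pow R (- κ) (suc m) * Hankel R (F (b₂ + e)) m) ∎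
        where
        -βe≈-κ : (- β) * e ≈ - κ
        -βe≈-κ = trans (sym (-‿distribˡ-* β e)) (-‿cong βe≈κ)

    NonVanishing : A → ℕ → Set ℓ
    NonVanishing β m = ∀ j → j N.< m → ¬ (Q β (suc j) ≈ 0#)

    NonVanishing-shift : ∀ {β e m} → β * e ≈ κ → NonVanishing β (suc m) → NonVanishing (b₂ + e) m
    NonVanishing-shift {β} {e} βe≈κ nz j j<m Q≈0 =
      nz (suc j) (N.s≤s j<m) (trans (Q-shift β e βe≈κ (suc j)) (trans (*-congˡ Q≈0) (zeroʳ β)))

    module WithInverses (inverse : ∀ x → ¬ (x ≈ 0#) → ∃ λ y → x * y ≈ 1#) where

      private
        module StepAt {β m} (nz : NonVanishing β (suc m)) where
          β≉0 : ¬ (β ≈ 0#)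
          β≉0 = nz 0 (N.s≤s N.z≤n)
          open Step β (proj₁ (inverse β β≉0)) (proj₂ (inverse β β≉0)) public
          nz′ : NonVanishing (b₂ + e) m
          nz′ = NonVanishing-shift βe≈κ nz

      hankel-F-even : ∀ m β → NonVanishing β m →
        Hankel R (F β) (suc (suc (2 N.* m))) ≈ pow R κ (suc m N.* suc m) * Q β (suc m)
      hankel-F-even zero β _ = trans (hankel-F-two β) (*-congʳ (sym (*-identityʳ κ)))
      hankel-F-even (suc m) β nz = begin
        Hankel R (F β) (2 N.+ 2 N.* suc m)
          ≡⟨ ≡.cong (λ k → Hankel R (F β) (2 N.+ k)) (N.*-suc 2 m) ⟩
        Hankel R (F β) (2 N.+ (2 N.+ 2 N.* m))
          ≈⟨ hankel-F-step (2 N.+ 2 N.* m) ⟩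
        (- β) * (pow R (- κ) (3 N.+ 2 N.* m) * Hankel R (F (b₂ + e)) (2 N.+ 2 N.* m))
          ≡⟨ ≡.cong (λ k → (- β) * (pow R (- κ) (suc k) * Hankel R (F (b₂ + e)) (2 N.+ 2 N.* m))) (N.*-suc 2 m) ⟨
        (- β) * (pow R (- κ) (suc (2 N.* suc m)) * Hankel R (F (b₂ + e)) (2 N.+ 2 N.* m))
          ≈⟨ *-congˡ (*-cong (pow-neg-odd κ (suc m)) (hankel-F-even m (b₂ + e) nz′)) ⟩
        (- β) * (- pow R κ (suc (2 N.* suc m)) * (pow R κ (suc m N.* suc m) * Q (b₂ + e) (suc m)))
          ≈⟨ solve 4 (λ b p k q → (:- b) :* ((:- p) :* (k :* q)) := (p :* k) :* (b :* q)) refl β _ _ _ ⟩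
        (pow R κ (suc (2 N.* suc m)) * pow R κ (suc m N.* suc m)) * (β * Q (b₂ + e) (suc m))
          ≈⟨ *-cong (sym (pow-+ κ (suc (2 N.* suc m)) (suc m N.* suc m))) (sym (Q-shift β e βe≈κ (suc m))) ⟩
        pow R κ (suc (2 N.* suc m) N.+ suc m N.* suc m) * Q β (suc (suc m))
          ≡⟨ ≡.cong (λ k → pow R κ k * Q β (suc (suc m))) (square-suc m) ⟩
        pow R κ (suc (suc m) N.* suc (suc m)) * Q β (suc (suc m)) ∎
        where
        open StepAt nz
        square-suc : ∀ m → suc (2 N.* suc m) N.+ suc m N.* suc m ≡ suc (suc m) N.* suc (suc m)
        square-suc = solve-∀

      hankel-F-odd : ∀ m β → NonVanishing β m →
        Hankel R (F β) (suc (2 N.* m)) ≈ sgn R (suc m) * (pow R κ (m N.* suc m) * Q β (suc m))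
      hankel-F-odd zero β _ = trans (hankel-F-one β) (solve 1 (λ b → :- b := (:- con 1ℤ) :* (con 1ℤ :* b)) refl β)
      hankel-F-odd (suc m) β nz = begin
        Hankel R (F β) (suc (2 N.* suc m))
          ≡⟨ ≡.cong (λ k → Hankel R (F β) (suc k)) (N.*-suc 2 m) ⟩
        Hankel R (F β) (2 N.+ suc (2 N.* m))
          ≈⟨ hankel-F-step (suc (2 N.* m)) ⟩
        (- β) * (pow R (- κ) (2 N.+ 2 N.* m) * Hankel R (F (b₂ + e)) (suc (2 N.* m)))
          ≡⟨ ≡.cong (λ k → (- β) * (pow R (- κ) k * Hankel R (F (b₂ + e)) (suc (2 N.* m)))) (N.*-suc 2 m) ⟨
        (- β) * (pow R (- κ) (2 N.* suc m) * Hankel R (F (b₂ + e)) (suc (2 N.* m)))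
          ≈⟨ *-congˡ (*-cong (pow-neg-even κ (suc m)) (hankel-F-odd m (b₂ + e) nz′)) ⟩
        (- β) * (pow R κ (2 N.* suc m) * (sgn R (suc m) * (pow R κ (m N.* suc m) * Q (b₂ + e) (suc m))))
          ≈⟨ solve 5 (λ b p s k q → (:- b) :* (p :* (s :* (k :* q))) := (:- s) :* ((p :* k) :* (b :* q))) refl β _ _ _ _ ⟩
        sgn R (suc (suc m)) * ((pow R κ (2 N.* suc m) * pow R κ (m N.* suc m)) * (β * Q (b₂ + e) (suc m)))
          ≈⟨ *-congˡ (*-cong (sym (pow-+ κ (2 N.* suc m) (m N.* suc m))) (sym (Q-shift β e βe≈κ (suc m)))) ⟩
        sgn R (suc (suc m)) * (pow R κ (2 N.* suc m N.+ m N.* suc m) * Q β (suc (suc m)))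
          ≡⟨ ≡.cong (λ k → sgn R (suc (suc m)) * (pow R κ k * Q β (suc (suc m)))) (pronic-suc m) ⟩
        sgn R (suc (suc m)) * (pow R κ (suc m N.* suc (suc m)) * Q β (suc (suc m))) ∎
        where
        open StepAt nz
        pronic-suc : ∀ m → 2 N.* suc m N.+ m N.* suc m ≡ suc m N.* suc (suc m)
        pronic-suc = solve-∀

      nonVanishing : (∀ n → ¬ (Hankel R G n ≈ 0#)) → ∀ m → NonVanishing b₂ m
      nonVanishing H≉0 zero j ()
      nonVanishing H≉0 (suc m) j j<1+m Q≈0 with N.m≤n⇒m<n∨m≡n (N.s≤s⁻¹ j<1+m)
      ... | inj₁ j<m = nonVanishing H≉0 m j j<m Q≈0
      ... | inj₂ ≡.refl = H≉0 (suc (suc (suc (2 N.* j)))) (begin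
        Hankel R G (suc (suc (suc (2 N.* j))))                 ≈⟨ hankel-G (suc (suc (2 N.* j))) ⟩
        p * Hankel R (F b₂) (suc (suc (2 N.* j)))              ≈⟨ *-congˡ (hankel-F-even j b₂ (nonVanishing H≉0 j)) ⟩
        p * (pow R κ (suc j N.* suc j) * Q b₂ (suc j))         ≈⟨ *-congˡ (trans (*-congˡ Q≈0) (zeroʳ _)) ⟩
        p * 0#                                                 ≈⟨ zeroʳ p ⟩
        0#                                                     ∎)
        where
        p : A
        p = pow R a (suc (suc (suc (2 N.* j))))

      module WithInverse (b₂⁻¹ : A) (b₂b₂⁻¹≈1 : b₂ * b₂⁻¹ ≈ 1#) where

        B′ : ℕ → A
        B′ = B R (κ * b₂⁻¹) ((κ + κ + b₂ * b₂) * b₂⁻¹) (- (κ * b₂⁻¹))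

        β≈b₂ : (κ + κ + b₂ * b₂) * b₂⁻¹ - (κ * b₂⁻¹ + κ * b₂⁻¹) ≈ b₂
        β≈b₂ = trans (solve 3 (λ k b i → (k :+ k :+ b :* b) :* i :- (k :* i :+ k :* i) := b :* (b :* i)) refl κ b₂ b₂⁻¹)
                     (trans (*-congˡ b₂b₂⁻¹≈1) (*-identityʳ b₂))

        α≈κ : (κ * b₂⁻¹) * (((κ + κ + b₂ * b₂) * b₂⁻¹ + - (κ * b₂⁻¹)) - κ * b₂⁻¹) ≈ κ
        α≈κ = trans (solve 3 (λ k b i → (k :* i) :* (((k :+ k :+ b :* b) :* i :+ (:- (k :* i))) :- k :* i) := k :* ((b :* i) :* (b :* i))) refl κ b₂ b₂⁻¹)
                    (trans (*-congˡ (trans (*-cong b₂b₂⁻¹≈1 b₂b₂⁻¹≈1) (*-identityʳ 1#))) (*-identityʳ κ))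

        Q≈b₂B : ∀ m → Q b₂ (suc m) ≈ b₂ * B′ m
        Q≈b₂B zero = sym (*-identityʳ b₂)
        Q≈b₂B (suc zero) = begin
          b₂ * b₂ + κ * 1#                       ≈⟨ solve 2 (λ b k → b :* b :+ k :* con 1ℤ := (b :* b :+ k) :* con 1ℤ) refl b₂ κ ⟩
          (b₂ * b₂ + κ) * 1#                     ≈⟨ *-congˡ b₂b₂⁻¹≈1 ⟨
          (b₂ * b₂ + κ) * (b₂ * b₂⁻¹)
            ≈⟨ solve 3 (λ k b i → (b :* b :+ k) :* (b :* i) := b :* ((k :+ k :+ b :* b) :* i :- k :* i)) refl κ b₂ b₂⁻¹ ⟩
          b₂ * B′ 1                              ∎
        Q≈b₂B (suc (suc m)) = begin
          b₂ * Q b₂ (suc (suc m)) + κ * Q b₂ (suc m)          ≈⟨ +-cong (*-congˡ (Q≈b₂B (suc m))) (*-congˡ (Q≈b₂B m)) ⟩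
          b₂ * (b₂ * B′ (suc m)) + κ * (b₂ * B′ m)
            ≈⟨ solve 4 (λ b k x y → b :* (b :* x) :+ k :* (b :* y) := b :* (b :* x :+ k :* y)) refl b₂ κ _ _ ⟩
          b₂ * (b₂ * B′ (suc m) + κ * B′ m)                   ≈⟨ *-congˡ (+-cong (*-congʳ (sym β≈b₂)) (*-congʳ (sym α≈κ))) ⟩
          b₂ * B′ (suc (suc m))                               ∎

        hankel-G-odd : ∀ m → NonVanishing b₂ m →
          Hankel R G (suc (2 N.* suc m)) ≈ b₂ * pow R a (suc (2 N.* suc m)) * pow R κ (suc m N.* suc m) * B′ m
        hankel-G-odd m nz = begin
          Hankel R G (suc (2 N.* suc m))                                     ≈⟨ hankel-G (2 N.* suc m) ⟩
          p * Hankel R (F b₂) (2 N.* suc m)                                  ≡⟨ ≡.cong (λ k → p * Hankel R (F b₂) k) (N.*-suc 2 m) ⟩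
          p * Hankel R (F b₂) (suc (suc (2 N.* m)))                          ≈⟨ *-congˡ (hankel-F-even m b₂ nz) ⟩
          p * (pow R κ (suc m N.* suc m) * Q b₂ (suc m))                     ≈⟨ *-congˡ (*-congˡ (Q≈b₂B m)) ⟩
          p * (pow R κ (suc m N.* suc m) * (b₂ * B′ m))
            ≈⟨ solve 4 (λ p k b x → p :* (k :* (b :* x)) := b :* p :* k :* x) refl p _ b₂ _ ⟩
          b₂ * p * pow R κ (suc m N.* suc m) * B′ m                          ∎
          where
          p : A
          p = pow R a (suc (2 N.* suc m))

        hankel-G-even : ∀ m → NonVanishing b₂ m →
          Hankel R G (2 N.* suc m) ≈ sgn R (suc m) * b₂ * pow R a (2 N.* suc m) * pow R κ (suc m N.* m) * B′ m
        hankel-G-even m nz = begin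
          Hankel R G (2 N.* suc m)                                           ≡⟨ ≡.cong (Hankel R G) (N.*-suc 2 m) ⟩
          Hankel R G (suc (suc (2 N.* m)))                                   ≈⟨ hankel-G (suc (2 N.* m)) ⟩
          p * Hankel R (F b₂) (suc (2 N.* m))                                ≈⟨ *-congˡ (hankel-F-odd m b₂ nz) ⟩
          p * (sgn R (suc m) * (pow R κ (m N.* suc m) * Q b₂ (suc m)))       ≈⟨ *-congˡ (*-congˡ (*-congˡ (Q≈b₂B m))) ⟩
          p * (sgn R (suc m) * (pow R κ (m N.* suc m) * (b₂ * B′ m)))
            ≈⟨ solve 5 (λ p s k b x → p :* (s :* (k :* (b :* x))) := s :* b :* p :* k :* x) refl p _ _ b₂ _ ⟩
          sgn R (suc m) * b₂ * p * pow R κ (m N.* suc m) * B′ m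
            ≡⟨ ≡.cong₂ (λ i k → sgn R (suc m) * b₂ * pow R a i * pow R κ k * B′ m) (N.*-suc 2 m) (N.*-comm (suc m) m) ⟨
          sgn R (suc m) * b₂ * pow R a (2 N.* suc m) * pow R κ (suc m N.* m) * B′ m ∎
          where
          p : A
          p = pow R a (suc (suc (2 N.* m)))

  

theorem2 : ∀ {c ℓ : Level} (R : CommutativeRing c ℓ) → IsField R →
    let open CommutativeRing R in
    ∀ (a b1 b2 cc b2inv : Carrier) → ¬ (b2 ≈ 0#) → b2 * b2inv ≈ 1# →
    ∀ (G : ℕ → Carrier) → IsG24 R a b1 b2 cc G →
    (∀ n → ¬ (Hankel R G n ≈ 0#)) →
    ∀ (n : ℕ) → 1 N.≤ n →
      (Hankel R G (suc (2 N.* n)) ≈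
         b2 * pow R a (suc (2 N.* n)) * pow R (a * cc) (n N.* n)
           * B R (a * cc * b2inv) ((a * cc + a * cc + b2 * b2) * b2inv) (- (a * cc * b2inv)) (n N.∸ 1))
      × (Hankel R G (2 N.* n) ≈
         sgn R n * b2 * pow R a (2 N.* n) * pow R (a * cc) (n N.* (n N.∸ 1))
           * B R (a * cc * b2inv) ((a * cc + a * cc + b2 * b2) * b2inv) (- (a * cc * b2inv)) (n N.∸ 1))
theorem2 R (_ , inverse) a b₁ b₂ cc b₂⁻¹ _ b₂b₂⁻¹≈1 G isG H≉0 (suc m) _ =
  hankel-G-odd m nonVanishingₘ , hankel-G-even m nonVanishingₘ
  where
  open HankelG24 R
  open Solution a b₁ b₂ cc G isG
  open WithInverses inverse
  open WithInverse b₂⁻¹ b₂b₂⁻¹≈1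
  nonVanishingₘ : NonVanishing b₂ m
  nonVanishingₘ = nonVanishing H≉0 m
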